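{- Let $p$ be a prime. The Laplacian characteristic polynomial of the power graph $\mathcal{P}(\mathbb{Z}_{p}\times \mathbb{Z}_{p} \times \mathbb{Z}_{p})$ is, up to the sign $(-1)^{p^3}$, \[ x(x-p^{3})(x-1)^{p^{2}+p}(x-p)^{p^{3}-p^{2}-p-2}; \] equivalently, $\det(xI-L)$ equals this polynomial, where $L$ is the Laplacian matrix of this power graph.
   Context: $\mathbb{Z}_m$ denotes the cyclic group of integers modulo $m$. The (undirected) power graph $\mathcal{P}(\mathcal{G})$ of a finite group $\mathcal{G}$ has vertex set $\mathcal{G}$, and two distinct elements $x,y$ are adjacent iff $y=x^{i}$ or $x=y^{j}$ for some positive integers $i,j$. The Laplacian matrix of a graph is $L=\mathrm{Deg}-A$, where $A$ is the adjacency matrix and $\mathrm{Deg}$ the diagonal matrix of vertex degrees. The paper defines the Laplacian characteristic polynomial as $\det(L-xI_n)$. -}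

module Defs where

open import Data.Nat using (ℕ; zero; suc; NonZero; _≤_)
import Data.Nat as ℕ
open import Data.Nat.DivMod using (_mod_)
open import Data.Integer using (ℤ; +_; -_) renaming (_+_ to _+ℤ_; _*_ to _*ℤ_)
open import Data.Fin using (Fin; toℕ; punchIn; _≟_)
import Data.Fin as F
open import Data.Vec using (Vec; replicate; zipWith)
open import Data.List using (List; []; _∷_; map)
open import Data.Bool using (if_then_else_)
open import Data.Product using (Σ; _×_)
open import Relation.Binary.PropositionalEquality using (_≡_)
open import Relation.Nullary using (¬_)
open import Relation.Nullary.Decidable using (⌊_⌋)

module Zp3 (p : ℕ) .{{_ : NonZero p}} where

  G : Set
  G = Vec (Fin p) 3

  _+ₚ_ : Fin p → Fin p → Fin p
  a +ₚ b = (toℕ a ℕ.+ toℕ b) mod p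

  _·_ : G → G → G
  x · y = zipWith _+ₚ_ x y

  e : G
  e = replicate 3 (0 mod p)

  _^_ : G → ℕ → G
  x ^ zero  = e
  x ^ suc i = x · (x ^ i)

  PowAdj : G → G → Set
  PowAdj x y = ¬ (x ≡ y) ×
               ((Σ ℕ λ i → (1 ≤ i) × (y ≡ x ^ i)) ⊎' (Σ ℕ λ j → (1 ≤ j) × (x ≡ y ^ j)))
    where
      open import Data.Sum renaming (_⊎_ to _⊎'_)

-- Univariate polynomials over ℤ as coefficient lists (constant term first)

Poly : Set
Poly = List ℤ

coeff : Poly → ℕ → ℤ
coeff []       _       = + 0
coeff (a ∷ _)  zero    = a
coeff (_ ∷ as) (suc k) = coeff as k

_≈P_ : Poly → Poly → Set
f ≈P g = ∀ k → coeff f k ≡ coeff g k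

infixl 6 _+P_ _-P_
infixl 7 _*P_
infixr 8 _^P_

_+P_ : Poly → Poly → Poly
[]       +P g        = g
(a ∷ f)  +P []       = a ∷ f
(a ∷ f)  +P (b ∷ g)  = (a +ℤ b) ∷ (f +P g)

negP : Poly → Poly
negP = map -_

_-P_ : Poly → Poly → Poly
f -P g = f +P negP g

_*P_ : Poly → Poly → Poly
[]      *P g = []
(a ∷ f) *P g = map (a *ℤ_) g +P (+ 0 ∷ (f *P g))

constP : ℤ → Poly
constP c = c ∷ []

oneP : Poly
oneP = constP (+ 1)

zeroP : Poly
zeroP = []

X : Poly
X = + 0 ∷ + 1 ∷ []

_^P_ : Poly → ℕ → Poly
f ^P zero  = oneP
f ^P suc n = f *P (f ^P n)

sumFin : ∀ {n} → (Fin n → Poly) → Poly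
sumFin {zero}  f = zeroP
sumFin {suc n} f = f F.zero +P sumFin (λ i → f (F.suc i))

signP : ℕ → Poly → Poly
signP zero          f = f
signP (suc zero)    f = negP f
signP (suc (suc k)) f = signP k f

det : ∀ {n} → (Fin n → Fin n → Poly) → Poly
det {zero}  M = oneP
det {suc n} M =
  sumFin (λ j → signP (toℕ j) (M F.zero j *P det (λ r c → M (F.suc r) (punchIn j c))))

sumℤ : ∀ {n} → (Fin n → ℤ) → ℤ
sumℤ {zero}  f = + 0
sumℤ {suc n} f = f F.zero +ℤ sumℤ (λ i → f (F.suc i))

degree : ∀ {n} → (Fin n → Fin n → ℤ) → Fin n → ℤ
degree A i = sumℤ (A i)

laplacian : ∀ {n} → (Fin n → Fin n → ℤ) → Fin n → Fin n → ℤ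
laplacian A i j = if ⌊ i ≟ j ⌋ then degree A i +ℤ (- A i j) else - A i j

charMatrix : ∀ {n} → (Fin n → Fin n → ℤ) → Fin n → Fin n → Poly
charMatrix L i j = (if ⌊ i ≟ j ⌋ then X else zeroP) -P constP (L i j)

charPoly : ∀ {n} → (Fin n → Fin n → ℤ) → Poly
charPoly L = det (charMatrix L)

module Submission where

-- The identity of Z_p³ is adjacent to every other element, and two non-identity
-- elements are adjacent exactly when they generate the same cyclic subgroup; so the
-- p³ - 1 non-identity vertices fall into p² + p + 1 cliques ("classes") of size p - 1.
-- In x I - L, subtracting the row of a class member w from that of another member v,
-- and then adding column v to column w, leaves row v with the single entry x - p, which
-- is expanded away; the column of w now carries the weight of both vertices.  After
-- p³ - p² - p - 2 such merges each class is a single vertex of weight p - 1, and merging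
-- these p² + p + 1 vertices in the same way pulls out x - 1 at each of p² + p steps,
-- leaving the 2 × 2 determinant (x - p³ + 1)(x - 1) - (p³ - 1) = x (x - p³).

open import Algebra.Bundles using (CommutativeRing)
open import Data.Nat using (ℕ)
open import Data.Nat.Primality using (Prime)

module Polynomials where

  open import Defs
  open import Data.Nat using (zero; suc)
  open import Data.Integer using (ℤ; +_; -_) renaming (_+_ to _+ℤ_; _*_ to _*ℤ_)
  import Data.Integer.Properties as ℤ
  open import Data.List using ([]; _∷_; map)
  open import Data.Product using (_,_)
  open import Relation.Binary.PropositionalEquality
  open import Algebra.Bundles using (CommutativeRing; Semiring)
  open import Algebra.Structures using (IsCommutativeRing)
  open import Level using (0ℓ)
  open import Algebra.Properties.CommutativeSemigroup ℤ.+-commutativeSemigroup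
    using (interchange) renaming (x∙yz≈y∙xz to +ℤ-left-comm)

  coeff-+P : ∀ f g k → coeff (f +P g) k ≡ coeff f k +ℤ coeff g k
  coeff-+P []      g       k       = sym (ℤ.+-identityˡ _)
  coeff-+P (a ∷ f) []      k       = sym (ℤ.+-identityʳ _)
  coeff-+P (a ∷ f) (b ∷ g) zero    = refl
  coeff-+P (a ∷ f) (b ∷ g) (suc k) = coeff-+P f g k

  coeff-negP : ∀ f k → coeff (negP f) k ≡ - coeff f k
  coeff-negP []      k       = refl
  coeff-negP (a ∷ f) zero    = refl
  coeff-negP (a ∷ f) (suc k) = coeff-negP f k

  coeff-scale : ∀ a g k → coeff (map (a *ℤ_) g) k ≡ a *ℤ coeff g k
  coeff-scale a []      k       = sym (ℤ.*-zeroʳ a)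
  coeff-scale a (b ∷ g) zero    = refl
  coeff-scale a (b ∷ g) (suc k) = coeff-scale a g k

  coeff-∷*P : ∀ a f g k → coeff ((a ∷ f) *P g) k ≡ a *ℤ coeff g k +ℤ coeff (+ 0 ∷ f *P g) k
  coeff-∷*P a f g k = trans (coeff-+P (map (a *ℤ_) g) _ k) (cong (_+ℤ _) (coeff-scale a g k))

  ∷-cong : ∀ a {f g} → f ≈P g → (a ∷ f) ≈P (a ∷ g)
  ∷-cong a f≈g zero    = refl
  ∷-cong a f≈g (suc k) = f≈g k

  *P-zeroʳ : ∀ f → (f *P []) ≈P []
  *P-zeroʳ []      k       = refl
  *P-zeroʳ (a ∷ f) zero    = refl
  *P-zeroʳ (a ∷ f) (suc k) = *P-zeroʳ f k

  +P-cong : ∀ {f f′ g g′} → f ≈P f′ → g ≈P g′ → (f +P g) ≈P (f′ +P g′)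
  +P-cong {f} {f′} {g} {g′} f≈f′ g≈g′ k = begin
    coeff (f +P g) k         ≡⟨ coeff-+P f g k ⟩
    coeff f k +ℤ coeff g k   ≡⟨ cong₂ _+ℤ_ (f≈f′ k) (g≈g′ k) ⟩
    coeff f′ k +ℤ coeff g′ k ≡⟨ coeff-+P f′ g′ k ⟨
    coeff (f′ +P g′) k       ∎
    where open ≡-Reasoning

  *P-congˡ : ∀ f {g g′} → g ≈P g′ → (f *P g) ≈P (f *P g′)
  *P-congˡ []      g≈g′ k = refl
  *P-congˡ (a ∷ f) {g} {g′} g≈g′ k = begin
    coeff ((a ∷ f) *P g) k                          ≡⟨ coeff-∷*P a f g k ⟩
    a *ℤ coeff g k +ℤ coeff (+ 0 ∷ f *P g) k    ≡⟨ cong₂ _+ℤ_ (cong (a *ℤ_) (g≈g′ k)) (∷-cong (+ 0) (*P-congˡ f g≈g′) k) ⟩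
    a *ℤ coeff g′ k +ℤ coeff (+ 0 ∷ f *P g′) k  ≡⟨ coeff-∷*P a f g′ k ⟨
    coeff ((a ∷ f) *P g′) k                         ∎
    where open ≡-Reasoning

  coeff-*P∷ : ∀ f b g k → coeff (f *P (b ∷ g)) k ≡ b *ℤ coeff f k +ℤ coeff (+ 0 ∷ f *P g) k
  coeff-*P∷ []      b g zero    = sym (trans (ℤ.+-identityʳ _) (ℤ.*-zeroʳ b))
  coeff-*P∷ []      b g (suc k) = sym (trans (ℤ.+-identityʳ _) (ℤ.*-zeroʳ b))
  coeff-*P∷ (a ∷ f) b g zero    = cong (_+ℤ + 0) (ℤ.*-comm a b)
  coeff-*P∷ (a ∷ f) b g (suc k) = begin
    coeff ((a ∷ f) *P (b ∷ g)) (suc k)                            ≡⟨ coeff-∷*P a f (b ∷ g) (suc k) ⟩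
    a *ℤ coeff g k +ℤ coeff (f *P (b ∷ g)) k                      ≡⟨ cong (a *ℤ coeff g k +ℤ_) (coeff-*P∷ f b g k) ⟩
    a *ℤ coeff g k +ℤ (b *ℤ coeff f k +ℤ coeff (+ 0 ∷ f *P g) k) ≡⟨ +ℤ-left-comm (a *ℤ coeff g k) (b *ℤ coeff f k) _ ⟩
    b *ℤ coeff f k +ℤ (a *ℤ coeff g k +ℤ coeff (+ 0 ∷ f *P g) k) ≡⟨ cong (b *ℤ coeff f k +ℤ_) (coeff-∷*P a f g k) ⟨
    b *ℤ coeff f k +ℤ coeff ((a ∷ f) *P g) k                      ∎
    where open ≡-Reasoning

  *P-comm : ∀ f g → (f *P g) ≈P (g *P f)
  *P-comm []      g       k       = sym (*P-zeroʳ g k)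
  *P-comm (a ∷ f) []      k       = *P-zeroʳ (a ∷ f) k
  *P-comm (a ∷ f) (b ∷ g) zero    = cong (_+ℤ + 0) (ℤ.*-comm a b)
  *P-comm (a ∷ f) (b ∷ g) (suc k) = begin
    coeff ((a ∷ f) *P (b ∷ g)) (suc k)                            ≡⟨ coeff-*P∷ (a ∷ f) b g (suc k) ⟩
    b *ℤ coeff f k +ℤ coeff ((a ∷ f) *P g) k                      ≡⟨ cong (b *ℤ coeff f k +ℤ_) (coeff-∷*P a f g k) ⟩
    b *ℤ coeff f k +ℤ (a *ℤ coeff g k +ℤ coeff (+ 0 ∷ f *P g) k)
      ≡⟨ cong (λ z → b *ℤ coeff f k +ℤ (a *ℤ coeff g k +ℤ z)) (∷-cong (+ 0) (*P-comm f g) k) ⟩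
    b *ℤ coeff f k +ℤ (a *ℤ coeff g k +ℤ coeff (+ 0 ∷ g *P f) k) ≡⟨ cong (b *ℤ coeff f k +ℤ_) (coeff-*P∷ g a f k) ⟨
    b *ℤ coeff f k +ℤ coeff (g *P (a ∷ f)) k                      ≡⟨ coeff-∷*P b g (a ∷ f) (suc k) ⟨
    coeff ((b ∷ g) *P (a ∷ f)) (suc k)                            ∎
    where open ≡-Reasoning

  *P-distribˡ : ∀ f g h → (f *P (g +P h)) ≈P (f *P g +P f *P h)
  *P-distribˡ []      g h k = refl
  *P-distribˡ (a ∷ f) g h k = begin
    coeff ((a ∷ f) *P (g +P h)) k
      ≡⟨ coeff-∷*P a f (g +P h) k ⟩
    a *ℤ coeff (g +P h) k +ℤ coeff (+ 0 ∷ f *P (g +P h)) k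
      ≡⟨ cong₂ _+ℤ_ (trans (cong (a *ℤ_) (coeff-+P g h k)) (ℤ.*-distribˡ-+ a _ _))
                    (trans (∷-cong (+ 0) (*P-distribˡ f g h) k) (coeff-+P (+ 0 ∷ f *P g) (+ 0 ∷ f *P h) k)) ⟩
    (a *ℤ coeff g k +ℤ a *ℤ coeff h k) +ℤ (coeff (+ 0 ∷ f *P g) k +ℤ coeff (+ 0 ∷ f *P h) k)
      ≡⟨ interchange (a *ℤ coeff g k) (a *ℤ coeff h k) (coeff (+ 0 ∷ f *P g) k) (coeff (+ 0 ∷ f *P h) k) ⟩
    (a *ℤ coeff g k +ℤ coeff (+ 0 ∷ f *P g) k) +ℤ (a *ℤ coeff h k +ℤ coeff (+ 0 ∷ f *P h) k)
      ≡⟨ cong₂ _+ℤ_ (coeff-∷*P a f g k) (coeff-∷*P a f h k) ⟨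
    coeff ((a ∷ f) *P g) k +ℤ coeff ((a ∷ f) *P h) k
      ≡⟨ coeff-+P ((a ∷ f) *P g) ((a ∷ f) *P h) k ⟨
    coeff ((a ∷ f) *P g +P (a ∷ f) *P h) k ∎
    where open ≡-Reasoning

  coeff-map*P : ∀ a g h k → coeff (map (a *ℤ_) g *P h) k ≡ a *ℤ coeff (g *P h) k
  coeff-map*P a []      h k = sym (ℤ.*-zeroʳ a)
  coeff-map*P a (b ∷ g) h k = begin
    coeff (map (a *ℤ_) (b ∷ g) *P h) k
      ≡⟨ coeff-∷*P (a *ℤ b) (map (a *ℤ_) g) h k ⟩
    a *ℤ b *ℤ coeff h k +ℤ coeff (+ 0 ∷ map (a *ℤ_) g *P h) k
      ≡⟨ cong₂ _+ℤ_ (ℤ.*-assoc a b _) (shifted k) ⟩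
    a *ℤ (b *ℤ coeff h k) +ℤ a *ℤ coeff (+ 0 ∷ g *P h) k
      ≡⟨ ℤ.*-distribˡ-+ a _ _ ⟨
    a *ℤ (b *ℤ coeff h k +ℤ coeff (+ 0 ∷ g *P h) k)
      ≡⟨ cong (a *ℤ_) (coeff-∷*P b g h k) ⟨
    a *ℤ coeff ((b ∷ g) *P h) k ∎
    where
    open ≡-Reasoning
    shifted : ∀ k → coeff (+ 0 ∷ map (a *ℤ_) g *P h) k ≡ a *ℤ coeff (+ 0 ∷ g *P h) k
    shifted zero    = sym (ℤ.*-zeroʳ a)
    shifted (suc k) = coeff-map*P a g h k

  *P-assoc : ∀ f g h → ((f *P g) *P h) ≈P (f *P (g *P h))
  *P-assoc []      g h k = refl
  *P-assoc (a ∷ f) g h k = begin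
    coeff ((map (a *ℤ_) g +P (+ 0 ∷ f *P g)) *P h) k
      ≡⟨ *P-comm (map (a *ℤ_) g +P (+ 0 ∷ f *P g)) h k ⟩
    coeff (h *P (map (a *ℤ_) g +P (+ 0 ∷ f *P g))) k
      ≡⟨ *P-distribˡ h (map (a *ℤ_) g) (+ 0 ∷ f *P g) k ⟩
    coeff (h *P map (a *ℤ_) g +P h *P (+ 0 ∷ f *P g)) k
      ≡⟨ coeff-+P (h *P map (a *ℤ_) g) (h *P (+ 0 ∷ f *P g)) k ⟩
    coeff (h *P map (a *ℤ_) g) k +ℤ coeff (h *P (+ 0 ∷ f *P g)) k
      ≡⟨ cong₂ _+ℤ_ (trans (*P-comm h (map (a *ℤ_) g) k) (coeff-map*P a g h k)) (coeff-*P∷ h (+ 0) (f *P g) k) ⟩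
    a *ℤ coeff (g *P h) k +ℤ (+ 0 *ℤ coeff h k +ℤ coeff (+ 0 ∷ h *P (f *P g)) k)
      ≡⟨ cong (a *ℤ coeff (g *P h) k +ℤ_) (ℤ.+-identityˡ _) ⟩
    a *ℤ coeff (g *P h) k +ℤ coeff (+ 0 ∷ h *P (f *P g)) k
      ≡⟨ cong (a *ℤ coeff (g *P h) k +ℤ_) (∷-cong (+ 0) (λ j → trans (*P-comm h (f *P g) j) (*P-assoc f g h j)) k) ⟩
    a *ℤ coeff (g *P h) k +ℤ coeff (+ 0 ∷ f *P (g *P h)) k
      ≡⟨ coeff-∷*P a f (g *P h) k ⟨
    coeff ((a ∷ f) *P (g *P h)) k ∎
    where open ≡-Reasoning

  constP0≈zeroP : constP (+ 0) ≈P zeroP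
  constP0≈zeroP zero    = refl
  constP0≈zeroP (suc k) = refl

  *P-identityˡ : ∀ f → (oneP *P f) ≈P f
  *P-identityˡ f k = begin
    coeff (oneP *P f) k                        ≡⟨ coeff-∷*P (+ 1) [] f k ⟩
    + 1 *ℤ coeff f k +ℤ coeff (constP (+ 0)) k ≡⟨ cong₂ _+ℤ_ (ℤ.*-identityˡ (coeff f k)) (constP0≈zeroP k) ⟩
    coeff f k +ℤ + 0                           ≡⟨ ℤ.+-identityʳ (coeff f k) ⟩
    coeff f k                                  ∎
    where open ≡-Reasoning

  +P-assoc : ∀ f g h → ((f +P g) +P h) ≈P (f +P (g +P h))
  +P-assoc f g h k = begin
    coeff ((f +P g) +P h) k              ≡⟨ coeff-+P (f +P g) h k ⟩
    coeff (f +P g) k +ℤ coeff h k        ≡⟨ cong (_+ℤ coeff h k) (coeff-+P f g k) ⟩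
    coeff f k +ℤ coeff g k +ℤ coeff h k  ≡⟨ ℤ.+-assoc (coeff f k) (coeff g k) (coeff h k) ⟩
    coeff f k +ℤ (coeff g k +ℤ coeff h k) ≡⟨ cong (coeff f k +ℤ_) (coeff-+P g h k) ⟨
    coeff f k +ℤ coeff (g +P h) k        ≡⟨ coeff-+P f (g +P h) k ⟨
    coeff (f +P (g +P h)) k              ∎
    where open ≡-Reasoning

  +P-comm : ∀ f g → (f +P g) ≈P (g +P f)
  +P-comm f g k = trans (coeff-+P f g k) (trans (ℤ.+-comm (coeff f k) (coeff g k)) (sym (coeff-+P g f k)))

  negP-inverseˡ : ∀ f → (negP f +P f) ≈P zeroP
  negP-inverseˡ f k = trans (coeff-+P (negP f) f k) (trans (cong (_+ℤ coeff f k) (coeff-negP f k)) (ℤ.+-inverseˡ (coeff f k)))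

  negP-cong : ∀ {f g} → f ≈P g → negP f ≈P negP g
  negP-cong {f} {g} f≈g k = trans (coeff-negP f k) (trans (cong -_ (f≈g k)) (sym (coeff-negP g k)))

  *P-cong : ∀ {f f′ g g′} → f ≈P f′ → g ≈P g′ → (f *P g) ≈P (f′ *P g′)
  *P-cong {f} {f′} {g} {g′} f≈f′ g≈g′ k =
    trans (*P-comm f g k) (trans (*P-congˡ g f≈f′ k) (trans (*P-comm g f′ k) (*P-congˡ f′ g≈g′ k)))

  -- Unlike the function type _≈P_, this record determines f and g, so Agda can infer them.
  record _≋_ (f g : Poly) : Set where
    constructor coeffwise
    field ≋⇒≈P : f ≈P g

  open _≋_ public

  ℤ[X]-isCommutativeRing : IsCommutativeRing _≋_ _+P_ _*P_ negP zeroP oneP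
  ℤ[X]-isCommutativeRing = record
    { isRing = record
      { +-isAbelianGroup = record
        { isGroup = record
          { isMonoid = record
            { isSemigroup = record
              { isMagma = record
                { isEquivalence = record
                  { refl  = coeffwise λ k → refl
                  ; sym   = λ (coeffwise f≈g) → coeffwise λ k → sym (f≈g k)
                  ; trans = λ (coeffwise f≈g) (coeffwise g≈h) → coeffwise λ k → trans (f≈g k) (g≈h k)
                  }
                ; ∙-cong = λ {f} {f′} {g} {g′} (coeffwise f≈f′) (coeffwise g≈g′) → coeffwise (+P-cong {f} {f′} {g} {g′} f≈f′ g≈g′)
                }
              ; assoc = λ f g h → coeffwise (+P-assoc f g h)
              }
            ; identity = (λ f → coeffwise λ k → refl) , λ f → coeffwise λ k → trans (coeff-+P f zeroP k) (ℤ.+-identityʳ _)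
            }
          ; inverse = (λ f → coeffwise (negP-inverseˡ f)) , λ f → coeffwise λ k → trans (+P-comm f (negP f) k) (negP-inverseˡ f k)
          ; ⁻¹-cong = λ {f} {g} (coeffwise f≈g) → coeffwise (negP-cong {f} {g} f≈g)
          }
        ; comm = λ f g → coeffwise (+P-comm f g)
        }
      ; *-cong = λ {f} {f′} {g} {g′} (coeffwise f≈f′) (coeffwise g≈g′) → coeffwise (*P-cong {f} {f′} {g} {g′} f≈f′ g≈g′)
      ; *-assoc = λ f g h → coeffwise (*P-assoc f g h)
      ; *-identity = (λ f → coeffwise (*P-identityˡ f)) , λ f → coeffwise λ k → trans (*P-comm f oneP k) (*P-identityˡ f k)
      ; distrib = (λ f g h → coeffwise (*P-distribˡ f g h)) , λ h f g → coeffwise λ k →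
          trans (*P-comm (f +P g) h k) (trans (*P-distribˡ h f g k) (+P-cong {h *P f} {f *P h} {h *P g} {g *P h} (*P-comm h f) (*P-comm h g) k))
      }
    ; *-comm = λ f g → coeffwise (*P-comm f g)
    }

  ℤ[X] : CommutativeRing 0ℓ 0ℓ
  ℤ[X] = record { isCommutativeRing = ℤ[X]-isCommutativeRing }

  open import Algebra.Definitions.RawSemiring (Semiring.rawSemiring (CommutativeRing.semiring ℤ[X])) using (_×_; _^_)
  open CommutativeRing ℤ[X] using (+-congˡ; -‿cong) renaming (sym to ≋-sym)

  ×-oneP≋constP : ∀ m → (m × oneP) ≋ constP (+ m)
  ×-oneP≋constP zero    = coeffwise λ k → sym (constP0≈zeroP k)
  ×-oneP≋constP (suc m) = +-congˡ (×-oneP≋constP m)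

  X-constP≋X-×oneP : ∀ m → (X -P constP (+ m)) ≋ (X -P m × oneP)
  X-constP≋X-×oneP m = +-congˡ (-‿cong (≋-sym (×-oneP≋constP m)))

  ^≡^P : ∀ f k → f ^ k ≡ f ^P k
  ^≡^P f zero    = refl
  ^≡^P f (suc k) = cong (f *P_) (^≡^P f k)

module FinEquality where

  open import Data.Bool using (Bool; true; false)
  open import Data.Nat using (suc)
  open import Data.Fin using (Fin; punchIn)
  import Data.Fin.Properties as Fin
  open import Data.Empty using (⊥-elim)
  open import Function using (_∘_)
  open import Relation.Nullary using (yes; no)
  open import Relation.Nullary.Decidable using (⌊_⌋)
  open import Relation.Binary.PropositionalEquality as ≡ using (_≡_; _≢_)

  _==_ : ∀ {n} → Fin n → Fin n → Bool
  u == w = ⌊ u Fin.≟ w ⌋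

  ≡⇒== : ∀ {n} {u w : Fin n} → u ≡ w → (u == w) ≡ true
  ≡⇒== {u = u} {w} u≡w with u Fin.≟ w
  ... | yes _   = ≡.refl
  ... | no u≢w  = ⊥-elim (u≢w u≡w)

  ==-refl : ∀ {n} (u : Fin n) → (u == u) ≡ true
  ==-refl u = ≡⇒== ≡.refl

  ≢⇒==false : ∀ {n} {u w : Fin n} → u ≢ w → (u == w) ≡ false
  ≢⇒==false {u = u} {w} u≢w with u Fin.≟ w
  ... | yes u≡w = ⊥-elim (u≢w u≡w)
  ... | no _    = ≡.refl

  ==false⇒≢ : ∀ {n} {u w : Fin n} → (u == w) ≡ false → u ≢ w
  ==false⇒≢ u≢w u≡w with ≡.trans (≡.sym u≢w) (≡⇒== u≡w)
  ... | ()

  ==⇒≡ : ∀ {n} {u w : Fin n} → (u == w) ≡ true → u ≡ w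
  ==⇒≡ {u = u} {w} eq with u Fin.≟ w
  ... | yes u≡w = u≡w

  ==-punchIn : ∀ {n} (v : Fin (suc n)) r c → (punchIn v r == punchIn v c) ≡ (r == c)
  ==-punchIn v r c with r Fin.≟ c
  ... | yes ≡.refl = ==-refl (punchIn v r)
  ... | no r≢c     = ≢⇒==false (r≢c ∘ Fin.punchIn-injective v r c)

module FinSums where

  open import Data.Nat using (ℕ; zero; suc; _∸_) renaming (_+_ to _+ℕ_; _*_ to _*ℕ_)
  import Data.Nat.Properties as ℕ
  open import Data.Fin using (Fin; zero; suc; punchIn; punchOut)
  import Data.Fin.Properties as Fin
  open import Function using (_∘_)
  open import Relation.Binary.PropositionalEquality
  open import Data.Bool using (Bool; if_then_else_; not)
  open FinEquality

  open import Algebra.Properties.CommutativeMonoid.Sum ℕ.+-0-commutativeMonoid public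
    using () renaming (sum to sumℕ; sum-remove to sumℕ-remove; sum-cong-≗ to sumℕ-cong; ∑-distrib-+ to sumℕ-distrib-+)
  open import Algebra.Properties.CommutativeMonoid.Sum ℕ.+-0-commutativeMonoid
    using (sum-replicate-zero)

  sumℕ-zero : ∀ {n} {f : Fin n → ℕ} → (∀ i → f i ≡ 0) → sumℕ f ≡ 0
  sumℕ-zero {n} f≡0 = trans (sumℕ-cong f≡0) (sum-replicate-zero n)

  sumℕ-single : ∀ {n} (f : Fin n → ℕ) i → (∀ j → j ≢ i → f j ≡ 0) → sumℕ f ≡ f i
  sumℕ-single {suc n} f i f≡0 = trans (sumℕ-remove {i = i} f)
    (trans (cong (f i +ℕ_) (sumℕ-zero λ j → f≡0 (punchIn i j) (Fin.punchInᵢ≢i i j))) (ℕ.+-identityʳ (f i)))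

  sumℕ-const : ∀ n m → sumℕ {n} (λ _ → m) ≡ n *ℕ m
  sumℕ-const zero    m = refl
  sumℕ-const (suc n) m = cong (m +ℕ_) (sumℕ-const n m)

  sumℕ-image : ∀ {m n} (f : Fin n → ℕ) (φ : Fin m → Fin n) → (∀ s t → φ s ≡ φ t → s ≡ t) →
               (∀ u → (∀ s → φ s ≢ u) → f u ≡ 0) → sumℕ f ≡ sumℕ (f ∘ φ)
  sumℕ-image {zero} f φ _ off = sumℕ-zero λ u → off u λ ()
  sumℕ-image {suc m} {suc n} f φ φ-inj off = begin
    sumℕ f                                         ≡⟨ sumℕ-remove {i = φ zero} f ⟩
    f (φ zero) +ℕ sumℕ (f ∘ punchIn (φ zero))      ≡⟨ cong (f (φ zero) +ℕ_) (sumℕ-image (f ∘ punchIn (φ zero)) φ′ φ′-inj off′) ⟩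
    f (φ zero) +ℕ sumℕ (f ∘ punchIn (φ zero) ∘ φ′) ≡⟨ cong (f (φ zero) +ℕ_) (sumℕ-cong λ s → cong f (Fin.punchIn-punchOut (φ0≢φ s))) ⟩
    sumℕ (f ∘ φ)                                   ∎
    where
    open ≡-Reasoning
    φ0≢φ : ∀ s → φ zero ≢ φ (suc s)
    φ0≢φ s eq with φ-inj zero (suc s) eq
    ... | ()
    φ′ : Fin m → Fin n
    φ′ s = punchOut (φ0≢φ s)
    φ′-inj : ∀ s t → φ′ s ≡ φ′ t → s ≡ t
    φ′-inj s t eq = Fin.suc-injective (φ-inj (suc s) (suc t) (Fin.punchOut-injective (φ0≢φ s) (φ0≢φ t) eq))
    off′ : ∀ r → (∀ s → φ′ s ≢ r) → f (punchIn (φ zero) r) ≡ 0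
    off′ r r∉φ′ = off (punchIn (φ zero) r) r∉φ
      where
      r∉φ : ∀ s → φ s ≢ punchIn (φ zero) r
      r∉φ zero    eq = Fin.punchInᵢ≢i (φ zero) r (sym eq)
      r∉φ (suc s) eq = r∉φ′ s (Fin.punchIn-injective (φ zero) _ r (trans (Fin.punchIn-punchOut (φ0≢φ s)) eq))
  sumℕ-image {suc m} {zero} f φ _ _ with φ zero
  ... | ()

  indicator : Bool → ℕ
  indicator b = if b then 1 else 0

  sumℕ-indicator : ∀ {n} (i : Fin n) → sumℕ (λ j → indicator (j == i)) ≡ 1
  sumℕ-indicator i = trans (sumℕ-single _ i λ j j≢i → cong indicator (≢⇒==false j≢i)) (cong indicator (==-refl i))

  sumℕ-allBut : ∀ {n} (i : Fin n) → sumℕ (λ j → indicator (not (j == i))) ≡ n ∸ 1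
  sumℕ-allBut {suc n} i = begin
    sumℕ g                         ≡⟨ sumℕ-remove {i = i} g ⟩
    g i +ℕ sumℕ (g ∘ punchIn i)    ≡⟨ cong₂ _+ℕ_ g-i (sumℕ-cong g-other) ⟩
    0 +ℕ sumℕ {n} (λ _ → 1)        ≡⟨ sumℕ-const n 1 ⟩
    n *ℕ 1                         ≡⟨ ℕ.*-identityʳ n ⟩
    n                              ∎
    where
    open ≡-Reasoning
    g : Fin (suc n) → ℕ
    g j = indicator (not (j == i))
    g-i : g i ≡ 0
    g-i = cong (indicator ∘ not) (==-refl i)
    g-other : ∀ r → g (punchIn i r) ≡ 1
    g-other r = cong (indicator ∘ not) (≢⇒==false (Fin.punchInᵢ≢i i r))

module RingIdentities {c ℓ} (R : CommutativeRing c ℓ) where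

  open CommutativeRing R
  open import Algebra.Properties.AbelianGroup +-abelianGroup using (⁻¹-∙-comm)
  open import Algebra.Properties.CommutativeSemigroup +-commutativeSemigroup using (x∙yz≈y∙xz)
  open import Relation.Binary.Reasoning.Setoid setoid

  -‿distrib-+ : ∀ x y → - (x + y) ≈ - x - y
  -‿distrib-+ x y = sym (⁻¹-∙-comm x y)

  [b+y]-y≈b : ∀ b y → b + y - y ≈ b
  [b+y]-y≈b b y = trans (+-assoc b y (- y)) (trans (+-congˡ (-‿inverseʳ y)) (+-identityʳ b))

  x-[b+x]≈-b : ∀ b x → x - (b + x) ≈ - b
  x-[b+x]≈-b b x = begin
    x - (b + x)     ≈⟨ +-congˡ (-‿distrib-+ b x) ⟩
    x + (- b - x)   ≈⟨ x∙yz≈y∙xz x (- b) (- x) ⟩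
    - b + (x - x)   ≈⟨ +-congˡ (-‿inverseʳ x) ⟩
    - b + 0#        ≈⟨ +-identityʳ (- b) ⟩
    - b             ∎

  x-[1+c]+c≈x-1 : ∀ x c → x - (1# + c) + c ≈ x - 1#
  x-[1+c]+c≈x-1 x c = begin
    x - (1# + c) + c       ≈⟨ +-assoc x _ c ⟩
    x + (- (1# + c) + c)   ≈⟨ +-congˡ (+-congʳ (-‿distrib-+ 1# c)) ⟩
    x + (- 1# - c + c)     ≈⟨ +-congˡ (+-assoc (- 1#) (- c) c) ⟩
    x + (- 1# + (- c + c)) ≈⟨ +-congˡ (+-congˡ (-‿inverseˡ c)) ⟩
    x + (- 1# + 0#)        ≈⟨ +-congˡ (+-identityʳ (- 1#)) ⟩
    x - 1#                 ∎

  [x-c][x-1]-c≈x[x-[1+c]] : ∀ x c → (x - c) * (x - 1#) - c ≈ x * (x - (1# + c))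
  [x-c][x-1]-c≈x[x-[1+c]] x c = begin
    (x - c) * (x - 1#) - c                      ≈⟨ +-congʳ (distribʳ (x - 1#) x (- c)) ⟩
    x * (x - 1#) + - c * (x - 1#) - c           ≈⟨ +-assoc _ _ _ ⟩
    x * (x - 1#) + (- c * (x - 1#) - c)         ≈⟨ +-congˡ (+-congˡ (*-identityʳ (- c))) ⟨
    x * (x - 1#) + (- c * (x - 1#) + - c * 1#)  ≈⟨ +-congˡ (distribˡ (- c) (x - 1#) 1#) ⟨
    x * (x - 1#) + - c * (x - 1# + 1#)          ≈⟨ +-congˡ (trans (*-congˡ x-1+1≈x) (*-comm (- c) x)) ⟩
    x * (x - 1#) + x * - c                      ≈⟨ distribˡ x _ _ ⟨
    x * (x - 1# - c)                            ≈⟨ *-congˡ (trans (+-assoc x (- 1#) (- c)) (+-congˡ (sym (-‿distrib-+ 1# c)))) ⟩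
    x * (x - (1# + c))                          ∎
    where
    x-1+1≈x : x - 1# + 1# ≈ x
    x-1+1≈x = trans (+-assoc x (- 1#) 1#) (trans (+-congˡ (-‿inverseˡ 1#)) (+-identityʳ x))

  x[yz]≈zy[x] : ∀ x y z → x * (y * z) ≈ z * y * x
  x[yz]≈zy[x] x y z = trans (*-comm x (y * z)) (*-congʳ (*-comm y z))

module Determinant {c ℓ} (R : CommutativeRing c ℓ) where

  open import Data.Nat using (ℕ; zero; suc) renaming (_+_ to _+ℕ_)
  import Data.Nat.Properties as ℕ
  open import Data.Fin using (Fin; zero; suc; toℕ; punchIn; punchOut; inject₁)
  import Data.Fin.Properties as Fin
  open import Data.Sum using (_⊎_; inj₁; inj₂)
  open import Data.Product using (_×_; _,_; proj₂)
  open import Data.Empty using (⊥-elim)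
  open import Function using (_∘_)
  open import Data.Vec.Functional using (updateAt)
  open import Data.Vec.Functional.Properties using (updateAt-updates; updateAt-minimal)
  open import Relation.Binary.PropositionalEquality as ≡ using (_≡_; _≢_)
  open import Relation.Binary.Definitions using (tri<; tri≈; tri>)
  open import Relation.Nullary using (yes; no)

  open CommutativeRing R hiding (zero)
  open import Algebra.Properties.Group +-group using (inverseʳ-unique)
  open import Algebra.Properties.Ring ring using (-‿distribʳ-*; -‿involutive; -0#≈0#; -1*x≈-x)
  open RingIdentities R using (-‿distrib-+; [b+y]-y≈b; x-[b+x]≈-b)
  open import Algebra.Properties.Semiring.Sum semiring using (sum; sum-cong-≋; sum-remove; ∑-distrib-+; ∑-comm; *-distribˡ-sum)
  open import Algebra.Properties.CommutativeSemigroup *-commutativeSemigroup using () renaming (x∙yz≈y∙xz to *-left-comm)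
  open import Algebra.Properties.CommutativeSemigroup ℕ.+-commutativeSemigroup using () renaming (x∙yz≈y∙xz to +ℕ-left-comm)
  open import Relation.Binary.Reasoning.Setoid setoid

  Matrix : ℕ → Set c
  Matrix n = Fin n → Fin n → Carrier

  transpose : ∀ {n} → Matrix n → Matrix n
  transpose M i j = M j i

  minor : ∀ {n} → Matrix (suc n) → Fin (suc n) → Fin (suc n) → Matrix n
  minor M i j r c = M (punchIn i r) (punchIn j c)

  signed : ℕ → Carrier → Carrier
  signed zero          x = x
  signed (suc zero)    x = - x
  signed (suc (suc k)) x = signed k x

  det : ∀ {n} → Matrix n → Carrier
  det {zero}  M = 1#
  det {suc n} M = sum λ j → signed (toℕ j) (M zero j * det (minor M zero j))

  sum-zero : ∀ {n} {f : Fin n → Carrier} → (∀ i → f i ≈ 0#) → sum f ≈ 0#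
  sum-zero {zero}  f≈0 = refl
  sum-zero {suc n} f≈0 = trans (+-cong (f≈0 zero) (sum-zero (f≈0 ∘ suc))) (+-identityˡ 0#)

  sum-neg : ∀ {n} (f : Fin n → Carrier) → sum (λ i → - f i) ≈ - sum f
  sum-neg {zero}  f = sym -0#≈0#
  sum-neg {suc n} f = trans (+-congˡ (sum-neg (f ∘ suc))) (sym (-‿distrib-+ _ _))

  sum-single : ∀ {n} (f : Fin (suc n) → Carrier) i → (∀ j → j ≢ i → f j ≈ 0#) → sum f ≈ f i
  sum-single f i f≈0 = begin
    sum f                         ≈⟨ sum-remove f ⟩
    f i + sum (f ∘ punchIn i)     ≈⟨ +-congˡ (sum-zero (λ j → f≈0 (punchIn i j) (Fin.punchInᵢ≢i i j))) ⟩
    f i + 0#                      ≈⟨ +-identityʳ (f i) ⟩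
    f i                           ∎

  signed-cong : ∀ k {x y} → x ≈ y → signed k x ≈ signed k y
  signed-cong zero          x≈y = x≈y
  signed-cong (suc zero)    x≈y = -‿cong x≈y
  signed-cong (suc (suc k)) x≈y = signed-cong k x≈y

  signed-suc : ∀ k x → signed (suc k) x ≈ - signed k x
  signed-suc zero          x = refl
  signed-suc (suc zero)    x = sym (-‿involutive x)
  signed-suc (suc (suc k)) x = signed-suc k x

  signed-+ℕ : ∀ a b x → signed (a +ℕ b) x ≈ signed a (signed b x)
  signed-+ℕ zero          b x = refl
  signed-+ℕ (suc zero)    b x = signed-suc b x
  signed-+ℕ (suc (suc a)) b x = signed-+ℕ a b x

  signed-distrib-+ : ∀ k x y → signed k (x + y) ≈ signed k x + signed k y
  signed-distrib-+ zero          x y = refl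
  signed-distrib-+ (suc zero)    x y = -‿distrib-+ x y
  signed-distrib-+ (suc (suc k)) x y = signed-distrib-+ k x y

  signed-*ˡ : ∀ k x y → signed k (x * y) ≈ x * signed k y
  signed-*ˡ zero          x y = refl
  signed-*ˡ (suc zero)    x y = -‿distribʳ-* x y
  signed-*ˡ (suc (suc k)) x y = signed-*ˡ k x y

  signed-zero : ∀ k → signed k 0# ≈ 0#
  signed-zero zero          = refl
  signed-zero (suc zero)    = -0#≈0#
  signed-zero (suc (suc k)) = signed-zero k

  signed-double : ∀ k x → signed (k +ℕ k) x ≈ x
  signed-double k x = trans (signed-+ℕ k k x) (involutive k)
    where
    involutive : ∀ k → signed k (signed k x) ≈ x
    involutive zero          = refl
    involutive (suc zero)    = -‿involutive x
    involutive (suc (suc k)) = involutive k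

  signed-comm : ∀ a b x → signed a (signed b x) ≈ signed b (signed a x)
  signed-comm a b x = begin
    signed a (signed b x) ≈⟨ signed-+ℕ a b x ⟨
    signed (a +ℕ b) x     ≈⟨ reflexive (≡.cong (λ k → signed k x) (ℕ.+-comm a b)) ⟩
    signed (b +ℕ a) x     ≈⟨ signed-+ℕ b a x ⟩
    signed b (signed a x) ∎

  signed-sum : ∀ k {n} (f : Fin n → Carrier) → signed k (sum f) ≈ sum (λ i → signed k (f i))
  signed-sum k {zero}  f = signed-zero k
  signed-sum k {suc n} f = trans (signed-distrib-+ k _ _) (+-congˡ (signed-sum k (f ∘ suc)))

  det-cong : ∀ {n} {M N : Matrix n} → (∀ i j → M i j ≈ N i j) → det M ≈ det N
  det-cong {zero}  M≈N = refl
  det-cong {suc n} M≈N = sum-cong-≋ λ j →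
    signed-cong (toℕ j) (*-cong (M≈N zero j) (det-cong λ r c → M≈N (suc r) (punchIn j c)))

  expansionTerm : ∀ {n} → Matrix (suc n) → Fin (suc n) → Carrier
  expansionTerm M j = signed (toℕ j) (M zero j * det (minor M zero j))

  det-linear-byTerms : ∀ {n} (M M₁ M₂ : Matrix (suc n)) t →
                       (∀ j → M zero j * det (minor M zero j) ≈
                              M₁ zero j * det (minor M₁ zero j) + t * (M₂ zero j * det (minor M₂ zero j))) →
                       det M ≈ det M₁ + t * det M₂
  det-linear-byTerms M M₁ M₂ t split = begin
    sum (expansionTerm M)
      ≈⟨ sum-cong-≋ (λ j → trans (signed-cong (toℕ j) (split j))
                       (trans (signed-distrib-+ (toℕ j) _ _) (+-congˡ (signed-*ˡ (toℕ j) t _)))) ⟩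
    sum (λ j → expansionTerm M₁ j + t * expansionTerm M₂ j)
      ≈⟨ ∑-distrib-+ (expansionTerm M₁) (λ j → t * expansionTerm M₂ j) ⟩
    det M₁ + sum (λ j → t * expansionTerm M₂ j)
      ≈⟨ +-congˡ (*-distribˡ-sum t (expansionTerm M₂)) ⟨
    det M₁ + t * det M₂ ∎

  det-rowLinear : ∀ {n} (i : Fin n) (M M₁ M₂ : Matrix n) t →
                  (∀ r c → r ≢ i → M r c ≈ M₁ r c) → (∀ r c → r ≢ i → M r c ≈ M₂ r c) →
                  (∀ c → M i c ≈ M₁ i c + t * M₂ i c) → det M ≈ det M₁ + t * det M₂
  det-rowLinear zero M M₁ M₂ t M≈M₁ M≈M₂ row = det-linear-byTerms M M₁ M₂ t λ j → begin
    M zero j * det (minor M zero j)                        ≈⟨ *-cong (row j) (det-cong λ r c → M≈M₁ (suc r) (punchIn j c) λ ()) ⟩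
    (M₁ zero j + t * M₂ zero j) * det (minor M₁ zero j)    ≈⟨ distribʳ _ _ _ ⟩
    M₁ zero j * det (minor M₁ zero j) + t * M₂ zero j * det (minor M₁ zero j)
      ≈⟨ +-congˡ (trans (*-assoc _ _ _) (*-congˡ (*-congˡ (det-cong λ r c →
           trans (sym (M≈M₁ (suc r) (punchIn j c) λ ())) (M≈M₂ (suc r) (punchIn j c) λ ()))))) ⟩
    M₁ zero j * det (minor M₁ zero j) + t * (M₂ zero j * det (minor M₂ zero j)) ∎
  det-rowLinear (suc i) M M₁ M₂ t M≈M₁ M≈M₂ row = det-linear-byTerms M M₁ M₂ t λ j → begin
    M zero j * det (minor M zero j)
      ≈⟨ *-congˡ (det-rowLinear i (minor M zero j) (minor M₁ zero j) (minor M₂ zero j) t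
                   (λ r c r≢i → M≈M₁ (suc r) (punchIn j c) (r≢i ∘ Fin.suc-injective))
                   (λ r c r≢i → M≈M₂ (suc r) (punchIn j c) (r≢i ∘ Fin.suc-injective))
                   (λ c → row (punchIn j c))) ⟩
    M zero j * (det (minor M₁ zero j) + t * det (minor M₂ zero j))
      ≈⟨ distribˡ _ _ _ ⟩
    M zero j * det (minor M₁ zero j) + M zero j * (t * det (minor M₂ zero j))
      ≈⟨ +-cong (*-congʳ (M≈M₁ zero j λ ())) (trans (*-left-comm _ _ _) (*-congˡ (*-congʳ (M≈M₂ zero j λ ())))) ⟩
    M₁ zero j * det (minor M₁ zero j) + t * (M₂ zero j * det (minor M₂ zero j)) ∎

  det-zeroRow : ∀ {n} (M : Matrix n) i → (∀ c → M i c ≈ 0#) → det M ≈ 0#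
  det-zeroRow M i row≈0 = begin
    det M                ≈⟨ det-rowLinear i M M M (- 1#) (λ _ _ _ → refl) (λ _ _ _ → refl) row ⟩
    det M + - 1# * det M ≈⟨ +-congˡ (-1*x≈-x (det M)) ⟩
    det M + - det M      ≈⟨ -‿inverseʳ (det M) ⟩
    0#                   ∎
    where
    row : ∀ c → M i c ≈ M i c + - 1# * M i c
    row c = begin
      M i c                ≈⟨ row≈0 c ⟩
      0#                   ≈⟨ -‿inverseʳ (M i c) ⟨
      M i c + - M i c      ≈⟨ +-congˡ (-1*x≈-x (M i c)) ⟨
      M i c + - 1# * M i c ∎

  punchIn-comm : ∀ {n} (j c : Fin (suc (suc n))) (c′ j′ : Fin (suc n)) →
                 punchIn j c′ ≡ c → punchIn c j′ ≡ j → ∀ x → punchIn j (punchIn c′ x) ≡ punchIn c (punchIn j′ x)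
  punchIn-comm zero     .(suc c′) c′       zero     ≡.refl _ x = ≡.refl
  punchIn-comm (suc j)  .zero     zero     j′       ≡.refl ≡.refl x = ≡.refl
  punchIn-comm {suc n} (suc j) .(suc (punchIn j c′)) (suc c′) (suc j′) ≡.refl eq zero = ≡.refl
  punchIn-comm {suc n} (suc j) .(suc (punchIn j c′)) (suc c′) (suc j′) ≡.refl eq (suc x) =
    ≡.cong suc (punchIn-comm j (punchIn j c′) c′ j′ ≡.refl (Fin.suc-injective eq) x)

  punchIn-parity : ∀ {n} (j c : Fin (suc (suc n))) (c′ j′ : Fin (suc n)) → punchIn j c′ ≡ c → punchIn c j′ ≡ j →
                   toℕ j +ℕ toℕ c′ ≡ suc (toℕ c +ℕ toℕ j′) ⊎ suc (toℕ j +ℕ toℕ c′) ≡ toℕ c +ℕ toℕ j′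
  punchIn-parity zero    .(suc c′) c′ zero ≡.refl _ = inj₂ (≡.sym (ℕ.+-identityʳ (suc (toℕ c′))))
  punchIn-parity (suc j) .zero zero j′ ≡.refl ≡.refl = inj₁ (ℕ.+-identityʳ (suc (toℕ j)))
  punchIn-parity {suc n} (suc j) .(suc (punchIn j c′)) (suc c′) (suc j′) ≡.refl eq
    with punchIn-parity j (punchIn j c′) c′ j′ ≡.refl (Fin.suc-injective eq)
  ... | inj₁ h = inj₁ (≡.cong suc (≡.trans (ℕ.+-suc (toℕ j) (toℕ c′))
                                    (≡.trans (≡.cong suc h) (≡.cong suc (≡.sym (ℕ.+-suc _ (toℕ j′)))))))
  ... | inj₂ h = inj₂ (≡.cong suc (≡.trans (≡.cong suc (ℕ.+-suc (toℕ j) (toℕ c′)))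
                                    (≡.trans (≡.cong suc h) (≡.sym (ℕ.+-suc _ (toℕ j′))))))

  -- Expanding along row 0 at column j and then along row r + 1 at column c gives the same
  -- sign as expanding in the opposite order.
  signed-deleteTwice : ∀ {n} (j c : Fin (suc (suc n))) (c′ j′ : Fin (suc n)) → punchIn j c′ ≡ c → punchIn c j′ ≡ j →
                       ∀ r a b d → signed (toℕ j) (a * signed (r +ℕ toℕ c′) (b * d)) ≈
                                   signed (suc (r +ℕ toℕ c)) (b * signed (toℕ j′) (a * d))
  signed-deleteTwice j c c′ j′ j∘c′≡c c∘j′≡j r a b d = begin
    signed (toℕ j) (a * signed (r +ℕ toℕ c′) (b * d))    ≈⟨ signed-cong (toℕ j) (signed-*ˡ (r +ℕ toℕ c′) a _) ⟨
    signed (toℕ j) (signed (r +ℕ toℕ c′) (a * (b * d)))  ≈⟨ signed-+ℕ (toℕ j) _ _ ⟨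
    signed (toℕ j +ℕ (r +ℕ toℕ c′)) (a * (b * d))        ≈⟨ sameParity (punchIn-parity j c c′ j′ j∘c′≡c c∘j′≡j) ⟩
    signed (T +ℕ toℕ j′) (a * (b * d))                   ≈⟨ signed-+ℕ T (toℕ j′) _ ⟩
    signed T (signed (toℕ j′) (a * (b * d)))             ≈⟨ signed-cong T (signed-cong (toℕ j′) (*-left-comm a b d)) ⟩
    signed T (signed (toℕ j′) (b * (a * d)))             ≈⟨ signed-cong T (signed-*ˡ (toℕ j′) b _) ⟩
    signed T (b * signed (toℕ j′) (a * d))               ∎
    where
    T = suc (r +ℕ toℕ c)
    r+[c+j′] : r +ℕ (toℕ c +ℕ toℕ j′) ≡ r +ℕ toℕ c +ℕ toℕ j′
    r+[c+j′] = ≡.sym (ℕ.+-assoc r (toℕ c) (toℕ j′))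
    sameParity : toℕ j +ℕ toℕ c′ ≡ suc (toℕ c +ℕ toℕ j′) ⊎ suc (toℕ j +ℕ toℕ c′) ≡ toℕ c +ℕ toℕ j′ →
                 signed (toℕ j +ℕ (r +ℕ toℕ c′)) (a * (b * d)) ≈ signed (T +ℕ toℕ j′) (a * (b * d))
    sameParity (inj₁ h) = reflexive (≡.cong (λ k → signed k (a * (b * d)))
      (≡.trans (+ℕ-left-comm (toℕ j) r (toℕ c′)) (≡.trans (≡.cong (r +ℕ_) h) (≡.trans (ℕ.+-suc r _) (≡.cong suc r+[c+j′])))))
    sameParity (inj₂ h) = reflexive (≡.cong (λ k → signed k (a * (b * d))) {suc (suc (toℕ j +ℕ (r +ℕ toℕ c′)))}
      (≡.trans (≡.cong (λ k → suc (suc k)) (+ℕ-left-comm (toℕ j) r (toℕ c′)))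
      (≡.trans (≡.cong suc (≡.sym (ℕ.+-suc r (toℕ j +ℕ toℕ c′))))
      (≡.trans (≡.cong (λ k → suc (r +ℕ k)) h) (≡.cong suc r+[c+j′])))))

  det-unitRow : ∀ {n} (M : Matrix (suc n)) r c → (∀ x → x ≢ c → M r x ≈ 0#) →
                det M ≈ signed (toℕ r +ℕ toℕ c) (M r c * det (minor M r c))
  det-unitRow M zero c row≈0 = sum-single (expansionTerm M) c λ j j≢c →
    trans (signed-cong (toℕ j) (trans (*-congʳ (row≈0 j j≢c)) (zeroˡ _))) (signed-zero (toℕ j))
  det-unitRow {suc n} M (suc r) c row≈0 = begin
    det M                                              ≈⟨ sum-remove {i = c} (expansionTerm M) ⟩
    expansionTerm M c + sum (expansionTerm M ∘ punchIn c) ≈⟨ +-cong term-c≈0 (sum-cong-≋ term) ⟩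
    0# + sum (λ j′ → signed T (b * rest j′))           ≈⟨ +-identityˡ _ ⟩
    sum (λ j′ → signed T (b * rest j′))                ≈⟨ signed-sum T (λ j′ → b * rest j′) ⟨
    signed T (sum (λ j′ → b * rest j′))                ≈⟨ signed-cong T (*-distribˡ-sum b rest) ⟨
    signed T (b * det (minor M (suc r) c))             ∎
    where
    T = suc (toℕ r +ℕ toℕ c)
    b = M (suc r) c
    rest : Fin (suc n) → Carrier
    rest = expansionTerm (minor M (suc r) c)
    term-c≈0 : expansionTerm M c ≈ 0#
    term-c≈0 = trans (signed-cong (toℕ c) (trans (*-congˡ (det-zeroRow (minor M zero c) r
                 (λ x → row≈0 (punchIn c x) (Fin.punchInᵢ≢i c x)))) (zeroʳ _))) (signed-zero (toℕ c))
    term : ∀ j′ → expansionTerm M (punchIn c j′) ≈ signed T (b * rest j′)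
    term j′ = trans (signed-cong (toℕ j) (*-congˡ expand-r)) (signed-deleteTwice j c c′ j′ j∘c′≡c ≡.refl (toℕ r) a b d)
      where
      j = punchIn c j′
      a = M zero j
      j≢c : j ≢ c
      j≢c = Fin.punchInᵢ≢i c j′
      c′ = punchOut j≢c
      j∘c′≡c : punchIn j c′ ≡ c
      j∘c′≡c = Fin.punchIn-punchOut j≢c
      d = det (minor (minor M (suc r) c) zero j′)
      expand-r : det (minor M zero j) ≈ signed (toℕ r +ℕ toℕ c′) (b * d)
      expand-r = trans (det-unitRow (minor M zero j) r c′ (λ x x≢c′ → row≈0 (punchIn j x) (x≢c′ ∘ λ eq →
                          Fin.punchIn-injective j x c′ (≡.trans eq (≡.sym j∘c′≡c)))))
                       (signed-cong (toℕ r +ℕ toℕ c′) (*-cong (reflexive (≡.cong (M (suc r)) j∘c′≡c))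
                         (det-cong λ x y → reflexive (≡.cong (M (suc (punchIn r x))) (punchIn-comm j c c′ j′ j∘c′≡c ≡.refl y)))))

  cornerMinor : ∀ {n} → Matrix (suc (suc n)) → Fin (suc n) → Fin (suc n) → Matrix n
  cornerMinor M k j r c = M (suc (punchIn k r)) (suc (punchIn j c))

  cornerTerm : ∀ {n} → Matrix (suc (suc n)) → Fin (suc n) → Fin (suc n) → Carrier
  cornerTerm M j k = - signed (toℕ j) (signed (toℕ k) (M zero (suc j) * (M (suc k) zero * det (transpose (cornerMinor M k j)))))

  -- Expansion along the first row, then of each minor except the leading one along its first column.
  rowColumnExpansion : ∀ {n} → Matrix (suc (suc n)) → Carrier
  rowColumnExpansion M = M zero zero * det (minor M zero zero) + sum λ j → sum λ k → cornerTerm M j k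

  det≈rowColumnExpansion : ∀ {n} → (∀ (N : Matrix (suc n)) → det (transpose N) ≈ det N) →
                           (M : Matrix (suc (suc n))) → det M ≈ rowColumnExpansion M
  det≈rowColumnExpansion det-transpose M = +-congˡ (sum-cong-≋ term)
    where
    term : ∀ j → expansionTerm M (suc j) ≈ sum (cornerTerm M j)
    term j = begin
      signed (suc (toℕ j)) (a * det N)                  ≈⟨ signed-suc (toℕ j) _ ⟩
      - signed (toℕ j) (a * det N)                      ≈⟨ -‿cong (signed-cong (toℕ j) (*-congˡ (det-transpose N))) ⟨
      - signed (toℕ j) (a * sum column)                 ≈⟨ -‿cong (signed-cong (toℕ j) (*-distribˡ-sum a column)) ⟩
      - signed (toℕ j) (sum λ k → a * column k)         ≈⟨ -‿cong (signed-sum (toℕ j) (λ k → a * column k)) ⟩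
      - sum (λ k → signed (toℕ j) (a * column k))       ≈⟨ sum-neg (λ k → signed (toℕ j) (a * column k)) ⟨
      sum (λ k → - signed (toℕ j) (a * column k))       ≈⟨ sum-cong-≋ (λ k → -‿cong (signed-cong (toℕ j) (sym (signed-*ˡ (toℕ k) a (unsignedColumn k))))) ⟩
      sum (cornerTerm M j)                              ∎
      where
      a = M zero (suc j)
      N = minor M zero (suc j)
      column : Fin _ → Carrier
      column = expansionTerm (transpose N)
      unsignedColumn : Fin _ → Carrier
      unsignedColumn k = M (suc k) zero * det (transpose (cornerMinor M k j))

  det-transpose : ∀ {n} (M : Matrix n) → det (transpose M) ≈ det M
  det-transpose {zero}        M = refl
  det-transpose {suc zero}    M = refl
  det-transpose {suc (suc n)} M = begin
    det (transpose M)                 ≈⟨ det≈rowColumnExpansion det-transpose (transpose M) ⟩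
    rowColumnExpansion (transpose M)  ≈⟨ +-cong (*-congˡ (det-transpose (minor M zero zero))) swapped ⟩
    rowColumnExpansion M              ≈⟨ det≈rowColumnExpansion det-transpose M ⟨
    det M                             ∎
    where
    cornerTerm-transpose : ∀ j k → cornerTerm (transpose M) j k ≈ cornerTerm M k j
    cornerTerm-transpose j k = -‿cong (begin
      signed (toℕ j) (signed (toℕ k) (M (suc j) zero * (M zero (suc k) * det (cornerMinor M j k))))
        ≈⟨ signed-comm (toℕ j) (toℕ k) _ ⟩
      signed (toℕ k) (signed (toℕ j) (M (suc j) zero * (M zero (suc k) * det (cornerMinor M j k))))
        ≈⟨ signed-cong (toℕ k) (signed-cong (toℕ j) (trans (*-left-comm _ _ _) (*-congˡ (*-congˡ (sym (det-transpose (cornerMinor M j k))))))) ⟩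
      signed (toℕ k) (signed (toℕ j) (M zero (suc k) * (M (suc j) zero * det (transpose (cornerMinor M j k))))) ∎)
    swapped : (sum λ j → sum λ k → cornerTerm (transpose M) j k) ≈ (sum λ k → sum λ j → cornerTerm M k j)
    swapped = trans (∑-comm (cornerTerm (transpose M))) (sum-cong-≋ λ k → sum-cong-≋ λ j → cornerTerm-transpose j k)

  alternatingSum-adjacent : ∀ {n} (f : Fin n → Carrier) (j k : Fin n) → toℕ k ≡ suc (toℕ j) →
                            (∀ i → i ≢ j → i ≢ k → f i ≈ 0#) → f j ≈ f k → sum (λ i → signed (toℕ i) (f i)) ≈ 0#
  alternatingSum-adjacent {suc (suc n)} f zero (suc zero) _ f≈0 fj≈fk = begin
    f zero + (- f (suc zero) + sum (λ i → signed (toℕ i) (f (suc (suc i)))))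
      ≈⟨ +-congˡ (+-congˡ (sum-zero λ i → trans (signed-cong (toℕ i) (f≈0 (suc (suc i)) (λ ()) (λ ()))) (signed-zero (toℕ i)))) ⟩
    f zero + (- f (suc zero) + 0#)  ≈⟨ +-congˡ (trans (+-identityʳ _) (-‿cong (sym fj≈fk))) ⟩
    f zero + - f zero               ≈⟨ -‿inverseʳ _ ⟩
    0#                              ∎
  alternatingSum-adjacent {suc n} f (suc j) (suc k) k≡1+j f≈0 fj≈fk = begin
    f zero + sum (λ i → signed (suc (toℕ i)) (f (suc i)))
      ≈⟨ +-cong (f≈0 zero (λ ()) (λ ())) (sum-cong-≋ λ i → signed-suc (toℕ i) (f (suc i))) ⟩
    0# + sum (λ i → - signed (toℕ i) (f (suc i)))   ≈⟨ +-identityˡ _ ⟩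
    sum (λ i → - signed (toℕ i) (f (suc i)))        ≈⟨ sum-neg (λ i → signed (toℕ i) (f (suc i))) ⟩
    - sum (λ i → signed (toℕ i) (f (suc i)))
      ≈⟨ -‿cong (alternatingSum-adjacent (f ∘ suc) j k (ℕ.suc-injective k≡1+j)
                   (λ i i≢j i≢k → f≈0 (suc i) (i≢j ∘ Fin.suc-injective) (i≢k ∘ Fin.suc-injective)) fj≈fk) ⟩
    - 0#                                            ≈⟨ -0#≈0# ⟩
    0#                                              ∎

  punchIn-adjacent : ∀ {n} (j k : Fin (suc n)) → toℕ k ≡ suc (toℕ j) → ∀ c →
                     punchIn j c ≡ punchIn k c ⊎ (punchIn j c ≡ k × punchIn k c ≡ j)
  punchIn-adjacent zero (suc zero) _ zero    = inj₂ (≡.refl , ≡.refl)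
  punchIn-adjacent zero (suc zero) _ (suc c) = inj₁ ≡.refl
  punchIn-adjacent (suc j) (suc k) _ zero    = inj₁ ≡.refl
  punchIn-adjacent {suc n} (suc j) (suc k) k≡1+j (suc c) with punchIn-adjacent j k (ℕ.suc-injective k≡1+j) c
  ... | inj₁ eq         = inj₁ (≡.cong suc eq)
  ... | inj₂ (eq , eq′) = inj₂ (≡.cong suc eq , ≡.cong suc eq′)

  punchOut-adjacent : ∀ {n} (i j k : Fin (suc n)) (i≢j : i ≢ j) (i≢k : i ≢ k) → toℕ k ≡ suc (toℕ j) →
                      toℕ (punchOut i≢k) ≡ suc (toℕ (punchOut i≢j))
  punchOut-adjacent zero zero k i≢j i≢k _ = ⊥-elim (i≢j ≡.refl)
  punchOut-adjacent zero (suc j) (suc k) i≢j i≢k k≡1+j = ℕ.suc-injective k≡1+j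
  punchOut-adjacent {suc n} (suc zero) zero (suc zero) i≢j i≢k _ = ⊥-elim (i≢k ≡.refl)
  punchOut-adjacent {suc (suc n)} (suc (suc i)) zero (suc zero) i≢j i≢k _ = ≡.refl
  punchOut-adjacent {suc n} (suc i) (suc j) (suc k) i≢j i≢k k≡1+j =
    ≡.cong suc (punchOut-adjacent i j k (i≢j ∘ ≡.cong suc) (i≢k ∘ ≡.cong suc) (ℕ.suc-injective k≡1+j))

  det-adjacentEqualColumns : ∀ {n} (M : Matrix n) (j k : Fin n) → toℕ k ≡ suc (toℕ j) →
                             (∀ r → M r j ≈ M r k) → det M ≈ 0#
  det-adjacentEqualColumns {suc n} M j k k≡1+j cols =
    alternatingSum-adjacent (λ i → M zero i * det (minor M zero i)) j k k≡1+j otherTerms equalTerms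
    where
    otherTerms : ∀ i → i ≢ j → i ≢ k → M zero i * det (minor M zero i) ≈ 0#
    otherTerms i i≢j i≢k = trans (*-congˡ (det-adjacentEqualColumns (minor M zero i) (punchOut i≢j) (punchOut i≢k)
      (punchOut-adjacent i j k i≢j i≢k k≡1+j)
      (λ r → trans (reflexive (≡.cong (M (suc r)) (Fin.punchIn-punchOut i≢j)))
             (trans (cols (suc r)) (reflexive (≡.cong (M (suc r)) (≡.sym (Fin.punchIn-punchOut i≢k)))))))) (zeroʳ _)
    sameColumn : ∀ r c → punchIn j c ≡ punchIn k c ⊎ (punchIn j c ≡ k × punchIn k c ≡ j) →
                 M (suc r) (punchIn j c) ≈ M (suc r) (punchIn k c)
    sameColumn r c (inj₁ eq)         = reflexive (≡.cong (M (suc r)) eq)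
    sameColumn r c (inj₂ (eq , eq′)) = trans (reflexive (≡.cong (M (suc r)) eq))
                                         (trans (sym (cols (suc r))) (reflexive (≡.cong (M (suc r)) (≡.sym eq′))))
    equalTerms : M zero j * det (minor M zero j) ≈ M zero k * det (minor M zero k)
    equalTerms = *-cong (cols zero) (det-cong λ r c → sameColumn r c (punchIn-adjacent j k k≡1+j c))

  det-adjacentEqualRows : ∀ {n} (M : Matrix n) (j k : Fin n) → toℕ k ≡ suc (toℕ j) →
                          (∀ c → M j c ≈ M k c) → det M ≈ 0#
  det-adjacentEqualRows M j k k≡1+j rows = trans (sym (det-transpose M)) (det-adjacentEqualColumns (transpose M) j k k≡1+j rows)

  det-rowAdditive : ∀ {n} (i : Fin n) (M M₁ M₂ : Matrix n) →
                    (∀ r c → r ≢ i → M r c ≈ M₁ r c) → (∀ r c → r ≢ i → M r c ≈ M₂ r c) →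
                    (∀ c → M i c ≈ M₁ i c + M₂ i c) → det M ≈ det M₁ + det M₂
  det-rowAdditive i M M₁ M₂ M≈M₁ M≈M₂ row =
    trans (det-rowLinear i M M₁ M₂ 1# M≈M₁ M≈M₂ λ c → trans (row c) (+-congˡ (sym (*-identityˡ _))))
          (+-congˡ (*-identityˡ _))

  replaceRow : ∀ {n} → Matrix n → Fin n → (Fin n → Carrier) → Matrix n
  replaceRow M i a = updateAt M i λ _ → a

  replaceRow-updates : ∀ {n} (M : Matrix n) i a c → replaceRow M i a i c ≈ a c
  replaceRow-updates M i a c = reflexive (≡.cong-app (updateAt-updates i M) c)

  replaceRow-minimal : ∀ {n} (M : Matrix n) i a r c → r ≢ i → replaceRow M i a r c ≈ M r c
  replaceRow-minimal M i a r c r≢i = reflexive (≡.cong-app (updateAt-minimal r i M r≢i) c)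

  replaceRows : ∀ {n} → Matrix n → Fin n → Fin n → (Fin n → Carrier) → (Fin n → Carrier) → Matrix n
  replaceRows M j k a b = replaceRow (replaceRow M k b) j a

  module _ {n} (M : Matrix n) {j k : Fin n} (j≢k : j ≢ k) where

    replaceRows-j : ∀ a b c → replaceRows M j k a b j c ≈ a c
    replaceRows-j a b = replaceRow-updates (replaceRow M k b) j a

    replaceRows-k : ∀ a b c → replaceRows M j k a b k c ≈ b c
    replaceRows-k a b c = trans (replaceRow-minimal (replaceRow M k b) j a k c (j≢k ∘ ≡.sym)) (replaceRow-updates M k b c)

    replaceRows-other : ∀ a b r c → r ≢ j → r ≢ k → replaceRows M j k a b r c ≈ M r c
    replaceRows-other a b r c r≢j r≢k = trans (replaceRow-minimal (replaceRow M k b) j a r c r≢j) (replaceRow-minimal M k b r c r≢k)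

    det-replaceRows-additiveʲ : ∀ a₁ a₂ b →
      det (replaceRows M j k (λ c → a₁ c + a₂ c) b) ≈ det (replaceRows M j k a₁ b) + det (replaceRows M j k a₂ b)
    det-replaceRows-additiveʲ a₁ a₂ b = det-rowAdditive j _ _ _ (offRow a₁) (offRow a₂)
      λ c → trans (replaceRows-j _ b c) (sym (+-cong (replaceRows-j a₁ b c) (replaceRows-j a₂ b c)))
      where
      offRow : ∀ a′ r c → r ≢ j → replaceRows M j k _ b r c ≈ replaceRows M j k a′ b r c
      offRow a′ r c r≢j = trans (replaceRow-minimal _ j _ r c r≢j) (sym (replaceRow-minimal _ j a′ r c r≢j))

    det-replaceRows-additiveᵏ : ∀ a b₁ b₂ →
      det (replaceRows M j k a (λ c → b₁ c + b₂ c)) ≈ det (replaceRows M j k a b₁) + det (replaceRows M j k a b₂)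
    det-replaceRows-additiveᵏ a b₁ b₂ = det-rowAdditive k _ _ _ (offRow b₁) (offRow b₂)
      λ c → trans (replaceRows-k a _ c) (sym (+-cong (replaceRows-k a b₁ c) (replaceRows-k a b₂ c)))
      where
      offRow : ∀ b′ r c → r ≢ k → replaceRows M j k a _ r c ≈ replaceRows M j k a b′ r c
      offRow b′ r c r≢k with r Fin.≟ j
      ... | yes ≡.refl = trans (replaceRows-j a _ c) (sym (replaceRows-j a b′ c))
      ... | no r≢j     = trans (replaceRows-other a _ r c r≢j r≢k) (sym (replaceRows-other a b′ r c r≢j r≢k))

    det-replaceRows≈ : ∀ L a b → (∀ c → L j c ≈ a c) → (∀ c → L k c ≈ b c) →
                       (∀ r c → r ≢ j → r ≢ k → L r c ≈ M r c) → det (replaceRows M j k a b) ≈ det L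
    det-replaceRows≈ L a b Lj Lk L≈M = det-cong entry
      where
      entry : ∀ r c → replaceRows M j k a b r c ≈ L r c
      entry r c with r Fin.≟ j | r Fin.≟ k
      ... | yes ≡.refl | _          = trans (replaceRows-j a b c) (sym (Lj c))
      ... | no _       | yes ≡.refl = trans (replaceRows-k a b c) (sym (Lk c))
      ... | no r≢j     | no r≢k     = trans (replaceRows-other a b r c r≢j r≢k) (sym (L≈M r c r≢j r≢k))

  -- Replacing both rows j and k by M j + M k gives determinant 0, which additivity in these
  -- two rows splits into det M + det N.
  det-swapAdjacentRows : ∀ {n} (M N : Matrix n) (j k : Fin n) → toℕ k ≡ suc (toℕ j) →
                         (∀ r c → r ≢ j → r ≢ k → N r c ≈ M r c) → (∀ c → N j c ≈ M k c) → (∀ c → N k c ≈ M j c) →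
                         det N ≈ - det M
  det-swapAdjacentRows M N j k k≡1+j N≈M Nj≈Mk Nk≈Mj = inverseʳ-unique (det M) (det N) (begin
    det M + det N                                                      ≈⟨ +-cong (+-identityˡ _) (+-identityʳ _) ⟨
    (0# + det M) + (det N + 0#)
      ≈⟨ +-cong (+-cong (equalRows≈0 (M j)) (det-replaceRows≈ M j≢k M (M j) (M k) (λ _ → refl) (λ _ → refl) (λ _ _ _ _ → refl)))
                (+-cong (det-replaceRows≈ M j≢k N (M k) (M j) Nj≈Mk Nk≈Mj N≈M) (equalRows≈0 (M k))) ⟨
    (det (S (M j) (M j)) + det (S (M j) (M k))) + (det (S (M k) (M j)) + det (S (M k) (M k)))
      ≈⟨ +-cong (det-replaceRows-additiveᵏ M j≢k (M j) (M j) (M k)) (det-replaceRows-additiveᵏ M j≢k (M k) (M j) (M k)) ⟨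
    det (S (M j) M[j+k]) + det (S (M k) M[j+k])                          ≈⟨ det-replaceRows-additiveʲ M j≢k (M j) (M k) M[j+k] ⟨
    det (S M[j+k] M[j+k])                                              ≈⟨ equalRows≈0 M[j+k] ⟩
    0#                                                                 ∎)
    where
    j≢k : j ≢ k
    j≢k j≡k = ℕ.1+n≢n (≡.sym (≡.trans (≡.cong toℕ j≡k) k≡1+j))
    S = replaceRows M j k
    M[j+k] : Fin _ → Carrier
    M[j+k] c = M j c + M k c
    equalRows≈0 : ∀ a → det (S a a) ≈ 0#
    equalRows≈0 a = det-adjacentEqualRows (S a a) j k k≡1+j λ c → trans (replaceRows-j M j≢k a a c) (sym (replaceRows-k M j≢k a a c))

  det-equalRows-atDistance : ∀ {n} (M : Matrix n) (j k : Fin n) d → suc (toℕ j +ℕ d) ≡ toℕ k →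
                             (∀ c → M j c ≈ M k c) → det M ≈ 0#
  det-equalRows-atDistance M j k zero k≡ rows =
    det-adjacentEqualRows M j k (≡.trans (≡.sym k≡) (≡.cong suc (ℕ.+-identityʳ (toℕ j)))) rows
  det-equalRows-atDistance {suc n} M j (suc k) (suc d) k≡ rows = begin
    det M       ≈⟨ -‿involutive (det M) ⟨
    - - det M   ≈⟨ -‿cong (det-swapAdjacentRows M N k′ (suc k) adjacent N≈M Nk′≈ Nk≈) ⟨
    - det N     ≈⟨ -‿cong (det-equalRows-atDistance N j k′ d k′≡ λ c → trans (Nj≈ c) (trans (rows c) (sym (Nk′≈ c)))) ⟩
    - 0#        ≈⟨ -0#≈0# ⟩
    0#          ∎
    where
    k′ = inject₁ k
    k′≡ : suc (toℕ j +ℕ d) ≡ toℕ k′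
    k′≡ = ≡.trans (ℕ.suc-injective (≡.trans (≡.cong suc (≡.sym (ℕ.+-suc (toℕ j) d))) k≡)) (≡.sym (Fin.toℕ-inject₁ k))
    adjacent : toℕ (suc k) ≡ suc (toℕ k′)
    adjacent = ≡.cong suc (≡.sym (Fin.toℕ-inject₁ k))
    N : Matrix (suc n)
    N = replaceRow (replaceRow M (suc k) (M k′)) k′ (M (suc k))
    k′≢k : k′ ≢ suc k
    k′≢k eq = ℕ.1+n≢n (≡.trans (≡.sym adjacent) (≡.cong toℕ (≡.sym eq)))
    N≈M : ∀ r c → r ≢ k′ → r ≢ suc k → N r c ≈ M r c
    N≈M r c r≢k′ r≢k = trans (replaceRow-minimal _ k′ _ r c r≢k′) (replaceRow-minimal M (suc k) _ r c r≢k)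
    Nk′≈ : ∀ c → N k′ c ≈ M (suc k) c
    Nk′≈ = replaceRow-updates _ k′ (M (suc k))
    Nk≈ : ∀ c → N (suc k) c ≈ M k′ c
    Nk≈ c = trans (replaceRow-minimal _ k′ _ (suc k) c (k′≢k ∘ ≡.sym)) (replaceRow-updates M (suc k) (M k′) c)
    Nj≈ : ∀ c → N j c ≈ M j c
    Nj≈ c = N≈M j c (λ eq → ℕ.m≢1+m+n (toℕ j) (≡.trans (≡.cong toℕ eq) (≡.sym k′≡)))
                   (λ eq → ℕ.m≢1+m+n (toℕ j) (≡.trans (≡.cong toℕ eq) (≡.sym k≡)))

  det-equalRows : ∀ {n} (M : Matrix n) (j k : Fin n) → j ≢ k → (∀ c → M j c ≈ M k c) → det M ≈ 0#
  det-equalRows M j k j≢k rows with ℕ.<-cmp (toℕ j) (toℕ k)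
  ... | tri< j<k _ _ = det-equalRows-atDistance M j k _ (proj₂ (ℕ.m≤n⇒∃[o]m+o≡n j<k)) rows
  ... | tri≈ _ j≡k _ = ⊥-elim (j≢k (Fin.toℕ-injective j≡k))
  ... | tri> _ _ k<j = det-equalRows-atDistance M k j _ (proj₂ (ℕ.m≤n⇒∃[o]m+o≡n k<j)) (sym ∘ rows)

  addRow : ∀ {n} → Matrix n → Fin n → Fin n → Carrier → Matrix n
  addRow M j k t = replaceRow M j λ c → M j c + t * M k c

  addColumn : ∀ {n} → Matrix n → Fin n → Fin n → Carrier → Matrix n
  addColumn M j k t = transpose (addRow (transpose M) j k t)

  det-addRow : ∀ {n} (M : Matrix n) {j k} t → j ≢ k → det (addRow M j k t) ≈ det M
  det-addRow M {j} {k} t j≢k = begin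
    det (addRow M j k t)  ≈⟨ det-rowLinear j _ M M′ t (replaceRow-minimal M j _)
                               (λ r c r≢j → trans (replaceRow-minimal M j _ r c r≢j) (sym (replaceRow-minimal M j (M k) r c r≢j)))
                               (λ c → trans (replaceRow-updates M j _ c) (+-congˡ (*-congˡ (sym (replaceRow-updates M j (M k) c))))) ⟩
    det M + t * det M′    ≈⟨ +-congˡ (*-congˡ (det-equalRows M′ j k j≢k λ c →
                               trans (replaceRow-updates M j (M k) c) (sym (replaceRow-minimal M j (M k) k c (j≢k ∘ ≡.sym))))) ⟩
    det M + t * 0#        ≈⟨ +-congˡ (zeroʳ t) ⟩
    det M + 0#            ≈⟨ +-identityʳ (det M) ⟩
    det M                 ∎
    where
    M′ = replaceRow M j (M k)

  det-addColumn : ∀ {n} (M : Matrix n) {j k} t → j ≢ k → det (addColumn M j k t) ≈ det M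
  det-addColumn M {j} {k} t j≢k =
    trans (det-transpose (addRow (transpose M) j k t)) (trans (det-addRow (transpose M) t j≢k) (det-transpose M))

  det-unitDiagonal : ∀ {n} (M : Matrix (suc n)) v → (∀ c → c ≢ v → M v c ≈ 0#) → det M ≈ M v v * det (minor M v v)
  det-unitDiagonal M v row≈0 = trans (det-unitRow M v v row≈0) (signed-double (toℕ v) _)

  -- Rows v and w of M differ by b (e_v - e_w); N deletes row and column v after adding column v to column w.
  det-merge : ∀ {n} (M : Matrix (suc n)) (N : Matrix n) (v w : Fin (suc n)) b → v ≢ w →
              (∀ u → u ≢ v → u ≢ w → M v u ≈ M w u) → M v v ≈ b + M w v → M w w ≈ b + M v w →
              (∀ r c → punchIn v c ≢ w → N r c ≈ M (punchIn v r) (punchIn v c)) →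
              (∀ r c → punchIn v c ≡ w → N r c ≈ M (punchIn v r) w + M (punchIn v r) v) →
              det M ≈ b * det N
  det-merge {n} M N v w b v≢w rows Mvv Mww N≈ N≈w = begin
    det M                        ≈⟨ det-addRow M (- 1#) v≢w ⟨
    det M₁                       ≈⟨ det-addColumn M₁ 1# (v≢w ∘ ≡.sym) ⟨
    det M₂                       ≈⟨ det-unitDiagonal M₂ v M₂-row-v ⟩
    M₂ v v * det (minor M₂ v v)  ≈⟨ *-cong M₂vv (det-cong minor≈N) ⟩
    b * det N                    ∎
    where
    M₁ M₂ : Matrix (suc n)
    M₁ = addRow M v w (- 1#)
    M₂ = addColumn M₁ w v 1#
    M₁-v : ∀ c → M₁ v c ≈ M v c - M w c
    M₁-v c = trans (replaceRow-updates M v _ c) (+-congˡ (-1*x≈-x _))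
    M₁-other : ∀ r c → r ≢ v → M₁ r c ≈ M r c
    M₁-other = replaceRow-minimal M v _
    M₂-other : ∀ r c → c ≢ w → M₂ r c ≈ M₁ r c
    M₂-other r c = replaceRow-minimal (transpose M₁) w _ c r
    M₂-w : ∀ r → M₂ r w ≈ M₁ r w + M₁ r v
    M₂-w r = trans (replaceRow-updates (transpose M₁) w _ r) (+-congˡ (*-identityˡ _))
    M₂vv : M₂ v v ≈ b
    M₂vv = begin
      M₂ v v            ≈⟨ M₂-other v v v≢w ⟩
      M₁ v v            ≈⟨ M₁-v v ⟩
      M v v - M w v     ≈⟨ +-congʳ Mvv ⟩
      b + M w v - M w v ≈⟨ [b+y]-y≈b b _ ⟩
      b                 ∎
    M₂-row-v : ∀ c → c ≢ v → M₂ v c ≈ 0#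
    M₂-row-v c c≢v with c Fin.≟ w
    ... | yes ≡.refl = begin
      M₂ v w                                      ≈⟨ M₂-w v ⟩
      M₁ v w + M₁ v v                             ≈⟨ +-cong (M₁-v w) (M₁-v v) ⟩
      (M v w - M w w) + (M v v - M w v)           ≈⟨ +-cong (+-congˡ (-‿cong Mww)) (+-congʳ Mvv) ⟩
      (M v w - (b + M v w)) + (b + M w v - M w v) ≈⟨ +-cong (x-[b+x]≈-b b _) ([b+y]-y≈b b _) ⟩
      - b + b                                     ≈⟨ -‿inverseˡ b ⟩
      0#                                          ∎
    ... | no c≢w = begin
      M₂ v c          ≈⟨ M₂-other v c c≢w ⟩
      M₁ v c          ≈⟨ M₁-v c ⟩
      M v c - M w c   ≈⟨ +-congʳ (rows c c≢v c≢w) ⟩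
      M w c - M w c   ≈⟨ -‿inverseʳ _ ⟩
      0#              ∎
    minor≈N : ∀ r c → minor M₂ v v r c ≈ N r c
    minor≈N r c with punchIn v c Fin.≟ w
    ... | yes eq = begin
      M₂ (punchIn v r) (punchIn v c)                 ≈⟨ reflexive (≡.cong (M₂ (punchIn v r)) eq) ⟩
      M₂ (punchIn v r) w                             ≈⟨ M₂-w _ ⟩
      M₁ (punchIn v r) w + M₁ (punchIn v r) v        ≈⟨ +-cong (M₁-other _ w r≢v) (M₁-other _ v r≢v) ⟩
      M (punchIn v r) w + M (punchIn v r) v          ≈⟨ N≈w r c eq ⟨
      N r c                                          ∎
      where r≢v = Fin.punchInᵢ≢i v r
    ... | no ne = trans (M₂-other _ _ ne) (trans (M₁-other _ _ (Fin.punchInᵢ≢i v r)) (sym (N≈ r c ne)))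

module ClassMatrix {c ℓ} (R : CommutativeRing c ℓ) where

  open import Algebra.Bundles using (Semiring)
  open import Data.Bool using (Bool; true; false; if_then_else_; _∨_; _∧_; not)
  open import Data.Nat using (ℕ; zero; suc) renaming (_+_ to _+ℕ_; _*_ to _*ℕ_)
  import Data.Nat.Properties as ℕ
  open import Data.Fin using (Fin; zero; suc; punchIn; punchOut)
  import Data.Fin.Properties as Fin
  open import Data.Product using (Σ-syntax; _,_)
  open import Data.Empty using (⊥-elim)
  import Data.Bool.Properties as Bool
  open import Function using (_∘_)
  open import Function.Bundles using (mk⇔)
  open import Relation.Nullary using (¬_; Dec; yes; no; ¬?)
  open import Relation.Nullary.Decidable using (map′; _×-dec_; toSum)
  open import Data.Sum using ([_,_]′)
  open import Relation.Binary.PropositionalEquality as ≡ using (_≡_; _≢_)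
  open import Level using (_⊔_)

  open CommutativeRing R hiding (zero)
  open Determinant R
  open import Algebra.Definitions.RawSemiring (Semiring.rawSemiring semiring) using (_×_; _^_)
  open import Algebra.Properties.Monoid.Mult +-monoid using (×-homo-+)
  open FinSums
  open FinEquality
  import Relation.Binary.Reasoning.Setoid setoid as ≈-Reasoning

  record Shape (n : ℕ) : Set where
    constructor shape
    field
      isApex  : Fin n → Bool
      related : Fin n → Fin n → Bool
      weight  : Fin n → ℕ

  -- With unit weights, a = x - deg(apex) and β + 1 = x - deg(u) for the other vertices u, this is
  -- x I - L for the graph joining the apices to everything and related vertices to each other.
  -- Merging vertices (below) preserves the shape but moves weight between columns.
  classMatrix : ∀ {n} → Shape n → Carrier → Carrier → Matrix n
  classMatrix (shape isApex related weight) a β u w =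
    if isApex w then (if u == w then a else 1#)
    else (if u == w then β else 0#) + (if isApex u ∨ related u w then weight w × 1# else 0#)

  weightSum : ∀ {n} → Shape n → (Fin n → Bool) → ℕ
  weightSum σ f = sumℕ λ u → if f u then Shape.weight σ u else 0

  totalWeight : ∀ {n} → Shape n → ℕ
  totalWeight σ = weightSum σ (not ∘ Shape.isApex σ)

  mergeShape : ∀ {n} → Shape (suc n) → Fin (suc n) → Fin (suc n) → Shape n
  mergeShape (shape isApex related weight) v w = shape
    (isApex ∘ punchIn v)
    (λ r c → related (punchIn v r) (punchIn v c))
    (λ c → if punchIn v c == w then weight w +ℕ weight v else weight (punchIn v c))

  splitWeight : ∀ x b m k → x + (if b then (m +ℕ k) × 1# else 0#) ≈
                            (x + (if b then m × 1# else 0#)) + (0# + (if b then k × 1# else 0#))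
  splitWeight x true  m k = begin
    x + (m +ℕ k) × 1#            ≈⟨ +-congˡ (×-homo-+ 1# m k) ⟩
    x + (m × 1# + k × 1#)        ≈⟨ +-assoc x _ _ ⟨
    x + m × 1# + k × 1#          ≈⟨ +-congˡ (+-identityˡ _) ⟨
    x + m × 1# + (0# + k × 1#)   ∎
    where open ≈-Reasoning
  splitWeight x false m k = trans (sym (+-identityʳ _)) (+-congˡ (sym (+-identityˡ 0#)))

  module _ {n} (σ : Shape (suc n)) (a β : Carrier) (v w : Fin (suc n)) where
    open Shape σ

    private
      M = classMatrix σ a β
      N = classMatrix (mergeShape σ v w) a β

    nonApexColumn : ∀ {u x} → isApex x ≡ false →
                    M u x ≡ (if u == x then β else 0#) + (if isApex u ∨ related u x then weight x × 1# else 0#)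
    nonApexColumn {u} {x} x∉A rewrite x∉A = ≡.refl

    det-classMatrix-merge : v ≢ w → isApex v ≡ false → isApex w ≡ false →
      (∀ u → isApex u ≡ false → related v u ≡ related w u) → (∀ u → isApex u ≡ false → related u v ≡ related u w) →
      det M ≈ β * det N
    det-classMatrix-merge v≢w v∉A w∉A sameRow sameColumn = det-merge M N v w β v≢w rows Mvv Mww N≈ N≈w
      where
      rows : ∀ u → u ≢ v → u ≢ w → M v u ≈ M w u
      rows u u≢v u≢w with isApex u in u∈A
      ... | true  rewrite ≢⇒==false (u≢v ∘ ≡.sym) | ≢⇒==false (u≢w ∘ ≡.sym) = refl
      ... | false rewrite ≢⇒==false (u≢v ∘ ≡.sym) | ≢⇒==false (u≢w ∘ ≡.sym) | v∉A | w∉A | sameRow u u∈A = refl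
      Mvv : M v v ≈ β + M w v
      Mvv rewrite nonApexColumn {v} v∉A | nonApexColumn {w} v∉A
                | ==-refl v | ≢⇒==false (v≢w ∘ ≡.sym) | v∉A | w∉A | sameRow v v∉A = +-congˡ (sym (+-identityˡ _))
      Mww : M w w ≈ β + M v w
      Mww rewrite nonApexColumn {w} w∉A | nonApexColumn {v} w∉A
                | ==-refl w | ≢⇒==false v≢w | v∉A | w∉A | sameRow w w∉A = +-congˡ (sym (+-identityˡ _))
      N≈ : ∀ r c → punchIn v c ≢ w → N r c ≈ M (punchIn v r) (punchIn v c)
      N≈ r c c≢w rewrite ==-punchIn v r c | ≢⇒==false c≢w = refl
      N≈w : ∀ r c → punchIn v c ≡ w → N r c ≈ M (punchIn v r) w + M (punchIn v r) v
      N≈w r c c≡w rewrite ≡.sym (==-punchIn v r c) | c≡w | w∉A | v∉A | ==-refl w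
                        | ≢⇒==false (Fin.punchInᵢ≢i v r) with isApex (punchIn v r) in r∈A
      ... | true  = splitWeight _ true (weight w) (weight v)
      ... | false rewrite sameColumn (punchIn v r) r∈A = splitWeight _ (related (punchIn v r) w) (weight w) (weight v)

  weightSum-merge : ∀ {n} (σ : Shape (suc n)) v w (f : Fin (suc n) → Bool) → v ≢ w → f v ≡ f w →
                    weightSum (mergeShape σ v w) (f ∘ punchIn v) ≡ weightSum σ f
  weightSum-merge σ v w f v≢w fv≡fw = begin
    weightSum (mergeShape σ v w) (f ∘ punchIn v) ≡⟨ sumℕ-cong split ⟩
    sumℕ (λ r → g (punchIn v r) +ℕ moved r)      ≡⟨ sumℕ-distrib-+ (g ∘ punchIn v) moved ⟩
    sumℕ (g ∘ punchIn v) +ℕ sumℕ moved           ≡⟨ ≡.cong (sumℕ (g ∘ punchIn v) +ℕ_) (sumℕ-single moved w′ moved≡0) ⟩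
    sumℕ (g ∘ punchIn v) +ℕ moved w′             ≡⟨ ℕ.+-comm _ (moved w′) ⟩
    moved w′ +ℕ sumℕ (g ∘ punchIn v)             ≡⟨ ≡.cong (_+ℕ sumℕ (g ∘ punchIn v)) moved-w′ ⟩
    g v +ℕ sumℕ (g ∘ punchIn v)                  ≡⟨ sumℕ-remove {i = v} g ⟨
    weightSum σ f                                ∎
    where
    open ≡.≡-Reasoning
    open Shape σ
    g : Fin _ → ℕ
    g u = if f u then weight u else 0
    moved : Fin _ → ℕ
    moved r = if punchIn v r == w then g v else 0
    w′ = punchOut v≢w
    atW : ∀ {x} → x ≡ w → (if f x then weight w +ℕ weight v else 0) ≡ g x +ℕ g v
    atW ≡.refl rewrite fv≡fw with f w
    ... | true  = ≡.refl
    ... | false = ≡.refl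
    split : ∀ r → (if f (punchIn v r) then Shape.weight (mergeShape σ v w) r else 0) ≡ g (punchIn v r) +ℕ moved r
    split r with punchIn v r == w in r≡w
    ... | true  = atW (==⇒≡ r≡w)
    ... | false = ≡.sym (ℕ.+-identityʳ _)
    moved≡0 : ∀ r → r ≢ w′ → moved r ≡ 0
    moved≡0 r r≢w′ rewrite ≢⇒==false {u = punchIn v r} {w}
      (r≢w′ ∘ λ eq → Fin.punchIn-injective v r w′ (≡.trans eq (≡.sym (Fin.punchIn-punchOut v≢w)))) = ≡.refl
    moved-w′ : moved w′ ≡ g v
    moved-w′ rewrite Fin.punchIn-punchOut v≢w | ==-refl w = ≡.refl

  totalWeight-merge : ∀ {n} (σ : Shape (suc n)) {v w} → v ≢ w → Shape.isApex σ v ≡ false → Shape.isApex σ w ≡ false →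
                      totalWeight (mergeShape σ v w) ≡ totalWeight σ
  totalWeight-merge σ {v} {w} v≢w v∉A w∉A =
    weightSum-merge σ v w (not ∘ Shape.isApex σ) v≢w (≡.cong not (≡.trans v∉A (≡.sym w∉A)))

  isApex-punchIn : ∀ {n} (isApex : Fin (suc n) → Bool) apex → (∀ u → isApex u ≡ u == apex) →
                   ∀ {v} (v≢apex : v ≢ apex) u → isApex (punchIn v u) ≡ u == punchOut v≢apex
  isApex-punchIn isApex apex isApex≡ {v} v≢apex u = ≡.trans (isApex≡ (punchIn v u))
    (≡.trans (≡.cong (punchIn v u ==_) (≡.sym (Fin.punchIn-punchOut v≢apex))) (==-punchIn v u (punchOut v≢apex)))

  det₂ : (M : Matrix 2) → det M ≈ M zero zero * M (suc zero) (suc zero) - M zero (suc zero) * M (suc zero) zero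
  det₂ M = trans (+-congˡ (+-identityʳ _)) (+-cong (*-congˡ (entry _)) (-‿cong (*-congˡ (entry _))))
    where
    entry : ∀ x → x * 1# + 0# ≈ x
    entry x = trans (+-identityʳ _) (*-identityʳ x)

  discrete : ∀ {n} → (Fin n → Bool) → (Fin n → ℕ) → Shape n
  discrete isApex weight = shape isApex (λ _ _ → false) weight

  det-discrete₂ : ∀ (isApex : Fin 2 → Bool) apex → (∀ u → isApex u ≡ u == apex) → ∀ weight a d →
                  det (classMatrix (discrete isApex weight) a d) ≈ a * d - totalWeight (discrete isApex weight) × 1#
  det-discrete₂ isApex apex isApex≡ weight a d = trans (det₂ M) (twoByTwo apex (isApex≡ zero) (isApex≡ (suc zero)))
    where
    open ≈-Reasoning
    M = classMatrix (discrete isApex weight) a d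
    twoByTwo : ∀ apex → isApex zero ≡ zero == apex → isApex (suc zero) ≡ suc zero == apex →
               M zero zero * M (suc zero) (suc zero) - M zero (suc zero) * M (suc zero) zero ≈
               a * d - totalWeight (discrete isApex weight) × 1#
    twoByTwo zero a₀ a₁ rewrite a₀ | a₁ | ℕ.+-identityʳ (weight (suc zero)) = begin
      a * (d + 0#) - (0# + weight (suc zero) × 1#) * 1#
        ≈⟨ +-cong (*-congˡ (+-identityʳ d)) (-‿cong (trans (*-identityʳ _) (+-identityˡ _))) ⟩
      a * d - weight (suc zero) × 1#                      ∎
    twoByTwo (suc zero) a₀ a₁ rewrite a₀ | a₁ | ℕ.+-identityʳ (weight zero) = begin
      (d + 0#) * a - 1# * (0# + weight zero × 1#)
        ≈⟨ +-cong (trans (*-congʳ (+-identityʳ d)) (*-comm d a)) (-‿cong (trans (*-identityˡ _) (+-identityˡ _))) ⟩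
      a * d - weight zero × 1#                            ∎

  det-discrete : ∀ k (isApex : Fin (suc (suc k)) → Bool) apex → (∀ u → isApex u ≡ u == apex) → ∀ weight a d →
                 det (classMatrix (discrete isApex weight) a d) ≈ d ^ k * (a * d - totalWeight (discrete isApex weight) × 1#)
  det-discrete zero isApex apex isApex≡ weight a d = trans (det-discrete₂ isApex apex isApex≡ weight a d) (sym (*-identityˡ _))
  det-discrete (suc k) isApex apex isApex≡ weight a d = begin
    det (classMatrix σ a d)
      ≈⟨ det-classMatrix-merge σ a d v w v≢w v∉A w∉A (λ _ _ → ≡.refl) (λ _ _ → ≡.refl) ⟩
    d * det (classMatrix σ′ a d)
      ≈⟨ *-congˡ (det-discrete k (isApex ∘ punchIn v) apex′ isApex′≡ (Shape.weight σ′) a d) ⟩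
    d * (d ^ k * (a * d - totalWeight σ′ × 1#))                       ≈⟨ *-assoc d _ _ ⟨
    d ^ suc k * (a * d - totalWeight σ′ × 1#)
      ≈⟨ *-congˡ (+-congˡ (-‿cong (reflexive (≡.cong (_× 1#) (totalWeight-merge σ v≢w v∉A w∉A))))) ⟩
    d ^ suc k * (a * d - totalWeight σ × 1#)                          ∎
    where
    open ≈-Reasoning
    σ = discrete isApex weight
    v w : Fin (suc (suc (suc k)))
    v = punchIn apex zero
    w = punchIn apex (suc zero)
    σ′ = mergeShape σ v w
    v≢w : v ≢ w
    v≢w eq with Fin.punchIn-injective apex zero (suc zero) eq
    ... | ()
    v∉A : isApex v ≡ false
    v∉A = ≡.trans (isApex≡ v) (≢⇒==false (Fin.punchInᵢ≢i apex zero))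
    w∉A : isApex w ≡ false
    w∉A = ≡.trans (isApex≡ w) (≢⇒==false (Fin.punchInᵢ≢i apex (suc zero)))
    v≢apex : v ≢ apex
    v≢apex = Fin.punchInᵢ≢i apex zero
    apex′ = punchOut v≢apex
    isApex′≡ : ∀ u → isApex (punchIn v u) ≡ u == apex′
    isApex′≡ = isApex-punchIn isApex apex isApex≡ v≢apex

  record IsClassStructure {n} (σ : Shape n) (m : ℕ) : Set where
    open Shape σ
    field
      apex          : Fin n
      isApex≡       : ∀ u → isApex u ≡ u == apex
      nonApex       : Σ[ u ∈ Fin n ] isApex u ≡ false
      related-refl  : ∀ u → isApex u ≡ false → related u u ≡ true
      related-sym   : ∀ u w → isApex u ≡ false → isApex w ≡ false → related u w ≡ true → related w u ≡ true
      related-trans : ∀ u w x → isApex u ≡ false → isApex w ≡ false → isApex x ≡ false →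
                      related u w ≡ true → related w x ≡ true → related u x ≡ true
      classWeight   : ∀ w → isApex w ≡ false → weightSum σ (λ u → not (isApex u) ∧ related u w) ≡ m

  record Mergeable {n} (σ : Shape n) (v w : Fin n) : Set where
    open Shape σ
    field
      v≢w : v ≢ w
      v∉A : isApex v ≡ false
      w∉A : isApex w ≡ false
      v∼w : related v w ≡ true

  mergeable? : ∀ {n} (σ : Shape n) v w → Dec (Mergeable σ v w)
  mergeable? σ v w = map′ (λ (v≢w , v∉A , w∉A , v∼w) → record { v≢w = v≢w ; v∉A = v∉A ; w∉A = w∉A ; v∼w = v∼w })
                          (λ m → Mergeable.v≢w m , Mergeable.v∉A m , Mergeable.w∉A m , Mergeable.v∼w m)
                          (¬? (v Fin.≟ w) ×-dec (isApex v Bool.≟ false) ×-dec (isApex w Bool.≟ false) ×-dec (related v w Bool.≟ true))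
    where open Shape σ

  module _ {n} {σ : Shape (suc n)} {m} (C : IsClassStructure σ m) {v w} (vw : Mergeable σ v w) where
    open Shape σ
    open IsClassStructure C
    open Mergeable vw

    sameRow : ∀ u → isApex u ≡ false → related v u ≡ related w u
    sameRow u u∉A = Bool.⇔→≡ {z = true} (mk⇔
      (λ v∼u → related-trans w v u w∉A v∉A u∉A (related-sym v w v∉A w∉A v∼w) v∼u)
      (λ w∼u → related-trans v w u v∉A w∉A u∉A v∼w w∼u))

    sameColumn : ∀ u → isApex u ≡ false → related u v ≡ related u w
    sameColumn u u∉A = Bool.⇔→≡ {z = true} (mk⇔
      (λ u∼v → related-trans u v w u∉A v∉A w∉A u∼v v∼w)
      (λ u∼w → related-trans u w v u∉A w∉A v∉A u∼w (related-sym v w v∉A w∉A v∼w)))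

    v≢apex : v ≢ apex
    v≢apex v≡apex with ≡.trans (≡.sym v∉A) (≡.trans (isApex≡ v) (≡⇒== v≡apex))
    ... | ()

    mergeClasses : IsClassStructure (mergeShape σ v w) m
    mergeClasses = record
      { apex          = punchOut v≢apex
      ; isApex≡       = isApex-punchIn isApex apex isApex≡ v≢apex
      ; nonApex       = punchOut v≢w , ≡.trans (≡.cong isApex (Fin.punchIn-punchOut v≢w)) w∉A
      ; related-refl  = λ u → related-refl (punchIn v u)
      ; related-sym   = λ u x → related-sym (punchIn v u) (punchIn v x)
      ; related-trans = λ u x y → related-trans (punchIn v u) (punchIn v x) (punchIn v y)
      ; classWeight   = λ x x∉A → ≡.trans
          (weightSum-merge σ v w (λ u → not (isApex u) ∧ related u (punchIn v x)) v≢w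
            (≡.cong₂ (λ a b → not a ∧ b) (≡.trans v∉A (≡.sym w∉A)) (sameRow (punchIn v x) x∉A)))
          (classWeight (punchIn v x) x∉A)
      }

  -- k + 1 is the number of classes, r the number of non-apex vertices in excess of one per class.
  record Factorisation {n} (σ : Shape n) (m : ℕ) (a β : Carrier) : Set (c ⊔ ℓ) where
    field
      k r   : ℕ
      size  : n ≡ suc (suc k) +ℕ r
      total : totalWeight σ ≡ suc k *ℕ m
      det≈  : det (classMatrix σ a β) ≈ β ^ r * ((β + m × 1#) ^ k * (a * (β + m × 1#) - totalWeight σ × 1#))

  module _ {n} {σ : Shape (suc (suc n))} {m} (C : IsClassStructure σ m) (a β : Carrier)
           (noneMergeable : ¬ (Σ[ v ∈ _ ] Σ[ w ∈ _ ] Mergeable σ v w)) where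
    open Shape σ
    open IsClassStructure C

    private
      singleton : ∀ u x → isApex u ≡ false → isApex x ≡ false → related u x ≡ true → u ≡ x
      singleton u x u∉A x∉A u∼x with u Fin.≟ x
      ... | yes u≡x = u≡x
      ... | no u≢x  = ⊥-elim (noneMergeable (u , x , record { v≢w = u≢x ; v∉A = u∉A ; w∉A = x∉A ; v∼w = u∼x }))

      unrelated : ∀ u x → isApex u ≡ false → isApex x ≡ false → u ≢ x → related u x ≡ false
      unrelated u x u∉A x∉A u≢x with related u x in u∼x
      ... | true  = ⊥-elim (u≢x (singleton u x u∉A x∉A u∼x))
      ... | false = ≡.refl

      weight≡m : ∀ x → isApex x ≡ false → weight x ≡ m
      weight≡m x x∉A = ≡.trans (≡.sym atX) (≡.trans (≡.sym (sumℕ-single _ x others≡0)) (classWeight x x∉A))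
        where
        atX : (if not (isApex x) ∧ related x x then weight x else 0) ≡ weight x
        atX rewrite x∉A | related-refl x x∉A = ≡.refl
        others≡0 : ∀ u → u ≢ x → (if not (isApex u) ∧ related u x then weight u else 0) ≡ 0
        others≡0 u u≢x with isApex u in u∈A
        ... | true  = ≡.refl
        ... | false rewrite unrelated u x u∈A x∉A u≢x = ≡.refl

      asDiscrete : ∀ u x → classMatrix σ a β u x ≈ classMatrix (discrete isApex weight) a (β + m × 1#) u x
      asDiscrete u x with isApex x in x∈A
      ... | true  = refl
      ... | false with u Fin.≟ x
      ...   | yes ≡.refl rewrite x∈A | related-refl u x∈A | weight≡m u x∈A = sym (+-identityʳ _)
      ...   | no u≢x with isApex u in u∈A
      ...     | true  = refl
      ...     | false rewrite unrelated u x u∈A x∈A u≢x = refl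

      totalWeight≡ : totalWeight σ ≡ suc n *ℕ m
      totalWeight≡ = begin
        totalWeight σ                                   ≡⟨ sumℕ-remove {i = apex} g ⟩
        g apex +ℕ sumℕ (g ∘ punchIn apex)               ≡⟨ ≡.cong₂ _+ℕ_ g-apex (sumℕ-cong g-other) ⟩
        0 +ℕ sumℕ {suc n} (λ _ → m)                     ≡⟨ sumℕ-const (suc n) m ⟩
        suc n *ℕ m                                      ∎
        where
        open ≡.≡-Reasoning
        g : Fin _ → ℕ
        g u = if not (isApex u) then weight u else 0
        g-apex : g apex ≡ 0
        g-apex rewrite isApex≡ apex | ==-refl apex = ≡.refl
        r∉A : ∀ r → isApex (punchIn apex r) ≡ false
        r∉A r = ≡.trans (isApex≡ _) (≢⇒==false (Fin.punchInᵢ≢i apex r))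
        g-other : ∀ r → g (punchIn apex r) ≡ m
        g-other r rewrite r∉A r = weight≡m _ (r∉A r)

    factorise-singletons : Factorisation σ m a β
    factorise-singletons = record
      { k = n ; r = 0 ; size = ≡.sym (ℕ.+-identityʳ _) ; total = totalWeight≡
      ; det≈ = trans (det-cong asDiscrete) (trans (det-discrete n isApex apex isApex≡ weight a (β + m × 1#)) (sym (*-identityˡ _)))
      }

  factorise-merge : ∀ {n} {σ : Shape (suc n)} {m} (C : IsClassStructure σ m) {v w} (vw : Mergeable σ v w) a β →
                    Factorisation (mergeShape σ v w) m a β → Factorisation σ m a β
  factorise-merge {σ = σ} {m} C {v} {w} vw a β merged = record
    { k     = k
    ; r     = suc r
    ; size  = ≡.trans (≡.cong suc size) (≡.sym (ℕ.+-suc (suc (suc k)) r))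
    ; total = ≡.trans (≡.sym sameTotal) total
    ; det≈  = begin
        det (classMatrix σ a β)                               ≈⟨ det-classMatrix-merge σ a β v w v≢w v∉A w∉A (sameRow C vw) (sameColumn C vw) ⟩
        β * det (classMatrix σ′ a β)                          ≈⟨ *-congˡ det≈ ⟩
        β * (β ^ r * (d ^ k * (a * d - totalWeight σ′ × 1#))) ≈⟨ *-assoc β _ _ ⟨
        β ^ suc r * (d ^ k * (a * d - totalWeight σ′ × 1#))   ≈⟨ *-congˡ (*-congˡ (+-congˡ (-‿cong (reflexive (≡.cong (_× 1#) sameTotal))))) ⟩
        β ^ suc r * (d ^ k * (a * d - totalWeight σ × 1#))    ∎
    }
    where
    open ≈-Reasoning
    open Shape σ
    open Mergeable vw
    open Factorisation merged
    σ′ = mergeShape σ v w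
    d = β + m × 1#
    sameTotal : totalWeight σ′ ≡ totalWeight σ
    sameTotal = totalWeight-merge σ v≢w v∉A w∉A

  factorise : ∀ {n} (σ : Shape n) {m} → IsClassStructure σ m → ∀ a β → Factorisation σ m a β
  factorise {zero} σ C a β with IsClassStructure.nonApex C
  ... | () , _
  factorise {suc zero} σ C a β with IsClassStructure.nonApex C | IsClassStructure.apex C | IsClassStructure.isApex≡ C zero
  ... | zero , 0∉A | zero | 0∈A with ≡.trans (≡.sym 0∉A) (≡.trans 0∈A (==-refl {1} zero))
  ...   | ()
  factorise {suc (suc n)} σ C a β =
    [ (λ (v , w , vw) → factorise-merge C vw a β (factorise (mergeShape σ v w) (mergeClasses C vw) a β))
    , factorise-singletons C a β
    ]′ (toSum (Fin.any? λ v → Fin.any? λ w → mergeable? σ v w))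

module ElementaryAbelian (p : ℕ) (pr : Prime p) where

  open import Defs using (module Zp3)
  open import Data.Nat using (zero; suc; _+_; _*_; _∸_; _%_; _<_; NonZero; z≤n; s≤s; s<s⁻¹; nonTrivial⇒n>1)
  import Data.Nat.Properties as ℕ
  open import Data.Nat.DivMod using (_mod_; m%n<n; [m+kn]%n≡m%n; [m+n]%n≡m%n; m<n⇒m%n≡m; %-distribˡ-*; %-distribˡ-+; m%n%n≡m%n; m*n%n≡0)
  open import Data.Nat.Divisibility using (n∣m⇒m%n≡0)
  open import Data.Nat.Coprimality using (Coprime; coprime-Bézout)
  open import Data.Nat.GCD using (module Bézout)
  open import Data.Nat.Primality using (prime⇒nonZero; prime⇒nonTrivial; prime⇒irreducible)
  open import Data.Nat.Tactic.RingSolver using (solve-∀)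
  open import Data.Fin using (Fin; toℕ; fromℕ<)
  import Data.Fin.Properties as Fin
  open import Data.Vec using ([]; _∷_)
  import Data.Vec.Properties as Vec
  open import Data.Sum using (inj₁; inj₂)
  open import Data.Product using (∃; _,_)
  open import Data.Empty using (⊥-elim)
  open import Relation.Nullary using (¬_; Dec; yes; no)
  import Relation.Nullary.Decidable as Dec
  open import Relation.Nullary.Decidable using (⌊_⌋)
  open import Data.Bool using (Bool; true)
  open import Relation.Binary.PropositionalEquality
  open import Function using (_∘_)

  instance
    p-nonZero : NonZero p
    p-nonZero = prime⇒nonZero pr

  open Zp3 p

  1<p : 1 < p
  1<p = nonTrivial⇒n>1 p {{prime⇒nonTrivial pr}}

  1%p≡1 : 1 % p ≡ 1
  1%p≡1 = m<n⇒m%n≡m 1<p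

  *-congˡ-% : ∀ z {x y} → x % p ≡ y % p → (z * x) % p ≡ (z * y) % p
  *-congˡ-% z {x} {y} x≡y = begin
    (z * x) % p                 ≡⟨ %-distribˡ-* z x p ⟩
    ((z % p) * (x % p)) % p     ≡⟨ cong (λ t → ((z % p) * t) % p) x≡y ⟩
    ((z % p) * (y % p)) % p     ≡⟨ %-distribˡ-* z y p ⟨
    (z * y) % p                 ∎
    where open ≡-Reasoning

  coprime-p : ∀ i → i % p ≢ 0 → Coprime i p
  coprime-p i i≢0 (d∣i , d∣p) with prime⇒irreducible pr d∣p
  ... | inj₁ d≡1   = d≡1
  ... | inj₂ refl  = ⊥-elim (i≢0 (n∣m⇒m%n≡0 i p d∣i))

  inverse-% : ∀ i → i % p ≢ 0 → ∃ λ j → (j * i) % p ≡ 1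
  inverse-% i i≢0 with coprime-Bézout (coprime-p i i≢0)
  ... | Bézout.+- x y eq = x , trans (cong (_% p) (sym eq)) (trans ([m+kn]%n≡m%n 1 y p) 1%p≡1)
  ... | Bézout.-+ x y eq = (p ∸ 1) * x , (begin
    ((p ∸ 1) * x * i) % p                     ≡⟨ [m+n]%n≡m%n _ p ⟨
    ((p ∸ 1) * x * i + p) % p                 ≡⟨ cong (_% p) (trans (cong (λ q → (q ∸ 1) * x * i + q) p≡1+p′) (shift p′ x i)) ⟩
    (1 + p′ * (1 + x * i)) % p                ≡⟨ cong (λ t → (1 + p′ * t) % p) eq ⟩
    (1 + p′ * (y * p)) % p                    ≡⟨ cong (λ t → (1 + t) % p) (sym (ℕ.*-assoc p′ y p)) ⟩
    (1 + p′ * y * p) % p                      ≡⟨ [m+kn]%n≡m%n 1 (p′ * y) p ⟩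
    1 % p                                     ≡⟨ 1%p≡1 ⟩
    1                                         ∎)
    where
    open ≡-Reasoning
    p′ = p ∸ 1
    p≡1+p′ : p ≡ suc p′
    p≡1+p′ = sym (ℕ.suc-pred p)
    shift : ∀ q x i → q * x * i + suc q ≡ 1 + q * (1 + x * i)
    shift = solve-∀

  *-cancelʳ-% : ∀ c i j → c % p ≢ 0 → (i * c) % p ≡ (j * c) % p → i % p ≡ j % p
  *-cancelʳ-% c i j c≢0 ic≡jc with inverse-% c c≢0
  ... | d , dc≡1 = begin
    i % p                 ≡⟨ cong (_% p) (ℕ.*-identityʳ i) ⟨
    (i * 1) % p           ≡⟨ *-congˡ-% i dc≡1%p ⟨
    (i * (d * c)) % p     ≡⟨ cong (_% p) (rearrange i d c) ⟩
    (d * (i * c)) % p     ≡⟨ *-congˡ-% d ic≡jc ⟩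
    (d * (j * c)) % p     ≡⟨ cong (_% p) (rearrange j d c) ⟨
    (j * (d * c)) % p     ≡⟨ *-congˡ-% j dc≡1%p ⟩
    (j * 1) % p           ≡⟨ cong (_% p) (ℕ.*-identityʳ j) ⟩
    j % p                 ∎
    where
    open ≡-Reasoning
    rearrange : ∀ i d c → i * (d * c) ≡ d * (i * c)
    rearrange = solve-∀
    dc≡1%p : (d * c) % p ≡ 1 % p
    dc≡1%p = trans dc≡1 (sym 1%p≡1)

  toℕ-mod : ∀ m → toℕ (m mod p) ≡ m % p
  toℕ-mod m = Fin.toℕ-fromℕ< _

  mod-≡ : ∀ {m n} → m % p ≡ n % p → m mod p ≡ n mod p
  mod-≡ {m} {n} eq = Fin.toℕ-injective (trans (toℕ-mod m) (trans eq (sym (toℕ-mod n))))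

  toℕ-% : ∀ (a : Fin p) → toℕ a % p ≡ toℕ a
  toℕ-% a = m<n⇒m%n≡m (Fin.toℕ<n a)

  0%p≡0 : 0 % p ≡ 0
  0%p≡0 = m<n⇒m%n≡m (ℕ.<-trans (s≤s z≤n) 1<p)

  scale : ℕ → Fin p → Fin p
  scale i a = (i * toℕ a) mod p

  scale-suc : ∀ i a → a +ₚ scale i a ≡ scale (suc i) a
  scale-suc i a = mod-≡ (begin
    (toℕ a + toℕ (scale i a)) % p        ≡⟨ cong (λ t → (toℕ a + t) % p) (toℕ-mod (i * toℕ a)) ⟩
    (toℕ a + (i * toℕ a) % p) % p        ≡⟨ %-distribˡ-+ (toℕ a) _ p ⟩
    (toℕ a % p + (i * toℕ a) % p % p) % p ≡⟨ cong (λ t → (toℕ a % p + t) % p) (m%n%n≡m%n (i * toℕ a) p) ⟩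
    (toℕ a % p + (i * toℕ a) % p) % p    ≡⟨ %-distribˡ-+ (toℕ a) _ p ⟨
    (toℕ a + i * toℕ a) % p              ∎)
    where open ≡-Reasoning

  scale-% : ∀ i a → scale (i % p) a ≡ scale i a
  scale-% i a = mod-≡ (begin
    (i % p * toℕ a) % p            ≡⟨ %-distribˡ-* (i % p) (toℕ a) p ⟩
    (i % p % p * (toℕ a % p)) % p  ≡⟨ cong (λ t → (t * (toℕ a % p)) % p) (m%n%n≡m%n i p) ⟩
    (i % p * (toℕ a % p)) % p      ≡⟨ %-distribˡ-* i (toℕ a) p ⟨
    (i * toℕ a) % p                ∎)
    where open ≡-Reasoning

  scale-* : ∀ j i a → scale j (scale i a) ≡ scale (j * i) a
  scale-* j i a = mod-≡ (begin
    (j * toℕ (scale i a)) % p      ≡⟨ cong (λ t → (j * t) % p) (toℕ-mod (i * toℕ a)) ⟩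
    (j * ((i * toℕ a) % p)) % p    ≡⟨ *-congˡ-% j (m%n%n≡m%n (i * toℕ a) p) ⟩
    (j * (i * toℕ a)) % p          ≡⟨ cong (_% p) (sym (ℕ.*-assoc j i (toℕ a))) ⟩
    (j * i * toℕ a) % p            ∎)
    where open ≡-Reasoning

  scale-1 : ∀ a → scale 1 a ≡ a
  scale-1 a = Fin.toℕ-injective (trans (toℕ-mod (1 * toℕ a)) (trans (cong (_% p) (ℕ.*-identityˡ (toℕ a))) (toℕ-% a)))

  scale-p : ∀ a → scale p a ≡ scale 0 a
  scale-p a = mod-≡ (trans (cong (_% p) (ℕ.*-comm p (toℕ a))) (trans (m*n%n≡0 (toℕ a) p) (sym 0%p≡0)))

  ^-scale : ∀ a b c i → (a ∷ b ∷ c ∷ []) ^ i ≡ scale i a ∷ scale i b ∷ scale i c ∷ []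
  ^-scale a b c zero = refl
  ^-scale a b c (suc i) rewrite ^-scale a b c i =
    cong₂ _∷_ (scale-suc i a) (cong₂ _∷_ (scale-suc i b) (cong₂ _∷_ (scale-suc i c) refl))

  ^-componentwise : ∀ {i j} → (∀ a → scale i a ≡ scale j a) → ∀ x → x ^ i ≡ x ^ j
  ^-componentwise {i} {j} i≗j (a ∷ b ∷ c ∷ []) rewrite ^-scale a b c i | ^-scale a b c j | i≗j a | i≗j b | i≗j c = refl

  ^-% : ∀ x i → x ^ (i % p) ≡ x ^ i
  ^-% x i = ^-componentwise {i % p} {i} (scale-% i) x

  ^-p : ∀ x → x ^ p ≡ e
  ^-p = ^-componentwise {p} {0} scale-p

  ^-1 : ∀ x → x ^ 1 ≡ x
  ^-1 (a ∷ b ∷ c ∷ []) rewrite ^-scale a b c 1 | scale-1 a | scale-1 b | scale-1 c = refl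

  ^-* : ∀ x i j → (x ^ i) ^ j ≡ x ^ (j * i)
  ^-* (a ∷ b ∷ c ∷ []) i j rewrite ^-scale a b c i | ^-scale (scale i a) (scale i b) (scale i c) j
    | ^-scale a b c (j * i) | scale-* j i a | scale-* j i b | scale-* j i c = refl

  scale-cancel : ∀ d i j → toℕ d ≢ 0 → scale i d ≡ scale j d → i % p ≡ j % p
  scale-cancel d i j d≢0 eq = *-cancelʳ-% (toℕ d) i j (d≢0 ∘ trans (sym (toℕ-% d)))
    (trans (sym (toℕ-mod (i * toℕ d))) (trans (cong toℕ eq) (toℕ-mod (j * toℕ d))))

  ^-cancel : ∀ x i j → x ≢ e → x ^ i ≡ x ^ j → i % p ≡ j % p
  ^-cancel (a ∷ b ∷ c ∷ []) i j x≢e xⁱ≡xʲ rewrite ^-scale a b c i | ^-scale a b c j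
    with Vec.∷-injective xⁱ≡xʲ
  ... | a≡ , rest with Vec.∷-injective rest
  ... | b≡ , rest′ with toℕ a ℕ.≟ 0 | toℕ b ℕ.≟ 0 | toℕ c ℕ.≟ 0
  ... | no a≢0  | _       | _       = scale-cancel a i j a≢0 a≡
  ... | yes _   | no b≢0  | _       = scale-cancel b i j b≢0 b≡
  ... | yes _   | yes _   | no c≢0  = scale-cancel c i j c≢0 (Vec.∷-injectiveˡ rest′)
  ... | yes a≡0 | yes b≡0 | yes c≡0 = ⊥-elim (x≢e (cong₂ _∷_ (zero′ a≡0) (cong₂ _∷_ (zero′ b≡0) (cong₂ _∷_ (zero′ c≡0) refl))))
    where
    zero′ : ∀ {d : Fin p} → toℕ d ≡ 0 → d ≡ 0 mod p
    zero′ d≡0 = Fin.toℕ-injective (trans d≡0 (sym (trans (toℕ-mod 0) 0%p≡0)))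

  ^≡e⇒%≡0 : ∀ x i → x ≢ e → x ^ i ≡ e → i % p ≡ 0
  ^≡e⇒%≡0 x i x≢e xⁱ≡e = trans (^-cancel x i 0 x≢e xⁱ≡e) 0%p≡0

  %≡0⇒^≡e : ∀ x i → i % p ≡ 0 → x ^ i ≡ e
  %≡0⇒^≡e x i i≡0 = trans (sym (^-% x i)) (cong (x ^_) i≡0)

  _∈⟨_⟩ : G → G → Set
  y ∈⟨ x ⟩ = ∃ λ i → y ≡ x ^ i

  _≟_ : (x y : G) → Dec (x ≡ y)
  _≟_ = Vec.≡-dec Fin._≟_

  _∈⟨_⟩? : ∀ y x → Dec (y ∈⟨ x ⟩)
  y ∈⟨ x ⟩? = Dec.map′ (λ (i , eq) → toℕ i , eq)
                       (λ (i , eq) → i mod p , trans eq (trans (sym (^-% x i)) (cong (x ^_) (sym (toℕ-mod i)))))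
                       (Fin.any? λ (i : Fin p) → y ≟ (x ^ toℕ i))

  ∈⟨⟩-refl : ∀ x → x ∈⟨ x ⟩
  ∈⟨⟩-refl x = 1 , sym (^-1 x)

  ∈⟨⟩-trans : ∀ {x y z} → y ∈⟨ x ⟩ → z ∈⟨ y ⟩ → z ∈⟨ x ⟩
  ∈⟨⟩-trans {x} (i , refl) (j , refl) = j * i , ^-* x i j

  ∈⟨⟩-sym : ∀ {x y} → y ≢ e → y ∈⟨ x ⟩ → x ∈⟨ y ⟩
  ∈⟨⟩-sym {x} y≢e (i , refl) with inverse-% i (y≢e ∘ %≡0⇒^≡e x i)
  ... | j , ji≡1 = j , sym (begin
    (x ^ i) ^ j        ≡⟨ ^-* x i j ⟩
    x ^ (j * i)        ≡⟨ ^-% x (j * i) ⟨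
    x ^ ((j * i) % p)  ≡⟨ cong (x ^_) ji≡1 ⟩
    x ^ 1              ≡⟨ ^-1 x ⟩
    x                  ∎)
    where open ≡-Reasoning

  PowAdj-e : ∀ y → y ≢ e → PowAdj e y
  PowAdj-e y y≢e = y≢e ∘ sym , inj₂ (p , ℕ.<⇒≤ 1<p , sym (^-p y))

  PowAdj-to-e : ∀ y → y ≢ e → PowAdj y e
  PowAdj-to-e y y≢e = y≢e , inj₁ (p , ℕ.<⇒≤ 1<p , sym (^-p y))

  PowAdj-irrefl : ∀ x → ¬ PowAdj x x
  PowAdj-irrefl x (x≢x , _) = x≢x refl

  ∈⟨⟩⇒PowAdj : ∀ {x y} → x ≢ y → y ≢ e → y ∈⟨ x ⟩ → PowAdj x y
  ∈⟨⟩⇒PowAdj x≢y y≢e (zero  , y≡e) = ⊥-elim (y≢e y≡e)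
  ∈⟨⟩⇒PowAdj x≢y y≢e (suc i , y≡x^i) = x≢y , inj₁ (suc i , s≤s z≤n , y≡x^i)

  PowAdj⇒∈⟨⟩ : ∀ {x y} → x ≢ e → PowAdj x y → y ∈⟨ x ⟩
  PowAdj⇒∈⟨⟩ x≢e (_ , inj₁ (i , _ , y≡xⁱ)) = i , y≡xⁱ
  PowAdj⇒∈⟨⟩ x≢e (_ , inj₂ (j , _ , x≡yʲ)) = ∈⟨⟩-sym x≢e (j , x≡yʲ)

  generator : G → Fin (p ∸ 1) → G
  generator x s = x ^ suc (toℕ s)

  private
    1+s%p≡1+s : ∀ (s : Fin (p ∸ 1)) → suc (toℕ s) % p ≡ suc (toℕ s)
    1+s%p≡1+s s = m<n⇒m%n≡m (subst (suc (toℕ s) <_) (ℕ.suc-pred p) (s≤s (Fin.toℕ<n s)))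

  generator-injective : ∀ {x} → x ≢ e → ∀ s t → generator x s ≡ generator x t → s ≡ t
  generator-injective {x} x≢e s t eq = Fin.toℕ-injective (ℕ.suc-injective
    (trans (sym (1+s%p≡1+s s)) (trans (^-cancel x (suc (toℕ s)) (suc (toℕ t)) x≢e eq) (1+s%p≡1+s t))))

  generator≢e : ∀ {x} → x ≢ e → ∀ s → generator x s ≢ e
  generator≢e {x} x≢e s xˢ≡e with trans (sym (1+s%p≡1+s s)) (^≡e⇒%≡0 x (suc (toℕ s)) x≢e xˢ≡e)
  ... | ()

  generator-generates : ∀ {x} → x ≢ e → ∀ s → x ∈⟨ generator x s ⟩
  generator-generates {x} x≢e s = ∈⟨⟩-sym (generator≢e x≢e s) (suc (toℕ s) , refl)

  generator-complete : ∀ {x y} → x ≢ e → y ≢ e → x ∈⟨ y ⟩ → ∃ λ s → y ≡ generator x s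
  generator-complete {x} {y} x≢e y≢e x∈⟨y⟩ with ∈⟨⟩-sym x≢e x∈⟨y⟩
  ... | i , y≡xⁱ with i % p in i%p≡
  ...   | zero  = ⊥-elim (y≢e (trans y≡xⁱ (%≡0⇒^≡e x i i%p≡)))
  ...   | suc j = fromℕ< j<p-1 , (begin
    y                      ≡⟨ y≡xⁱ ⟩
    x ^ i                  ≡⟨ ^-% x i ⟨
    x ^ (i % p)            ≡⟨ cong (x ^_) i%p≡ ⟩
    x ^ suc j              ≡⟨ cong (λ t → x ^ suc t) (Fin.toℕ-fromℕ< j<p-1) ⟨
    generator x (fromℕ< j<p-1) ∎)
    where
    open ≡-Reasoning
    j<p-1 : j < p ∸ 1
    j<p-1 = s<s⁻¹ (subst (suc j <_) (sym (ℕ.suc-pred p)) (subst (_< p) i%p≡ (m%n<n i p)))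

  _∈⟨_⟩ᵇ : G → G → Bool
  y ∈⟨ x ⟩ᵇ = ⌊ y ∈⟨ x ⟩? ⌋

  ∈⟨⟩ᵇ-complete : ∀ {x y} → y ∈⟨ x ⟩ → y ∈⟨ x ⟩ᵇ ≡ true
  ∈⟨⟩ᵇ-complete {x} {y} y∈⟨x⟩ with y ∈⟨ x ⟩?
  ... | yes _      = refl
  ... | no y∉⟨x⟩   = ⊥-elim (y∉⟨x⟩ y∈⟨x⟩)

  ∈⟨⟩ᵇ-sound : ∀ {x y} → y ∈⟨ x ⟩ᵇ ≡ true → y ∈⟨ x ⟩
  ∈⟨⟩ᵇ-sound {x} {y} eq with y ∈⟨ x ⟩?
  ... | yes y∈⟨x⟩ = y∈⟨x⟩

open import Defs
open import Data.Nat using (ℕ; _∸_)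
import Data.Nat as ℕ
open import Data.Nat.Primality using (Prime; prime⇒nonZero)
open import Data.Integer using (ℤ; +_)
open import Data.Fin using (Fin)
open import Data.Product using (_×_)
open import Function.Bundles using (_↔_; Inverse)
open import Relation.Binary.PropositionalEquality using (_≡_)
open import Relation.Nullary using (¬_)
open Polynomials using (ℤ[X]; _≋_; coeffwise; ≋⇒≈P; constP0≈zeroP; ×-oneP≋constP; X-constP≋X-×oneP; ^≡^P)
open FinEquality
open FinSums

module DefsAgreement where

  open import Data.Nat using (zero; suc)
  open import Data.Fin using (zero; suc; toℕ; punchIn)
  open import Function using (_∘_)
  open import Relation.Binary.PropositionalEquality using (refl; trans; cong; cong₂)
  open import Data.Integer using () renaming (_+_ to _+ℤ_)
  open import Algebra.Properties.Semiring.Sum (CommutativeRing.semiring ℤ[X]) using (sum; sum-cong-≗)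
  open Determinant ℤ[X] using (signed)

  sumFin≡sum : ∀ {n} (f : Fin n → Poly) → sumFin f ≡ sum f
  sumFin≡sum {zero}  f = refl
  sumFin≡sum {suc n} f = cong (f zero +P_) (sumFin≡sum (f ∘ suc))

  signP≡signed : ∀ k f → signP k f ≡ signed k f
  signP≡signed zero          f = refl
  signP≡signed (suc zero)    f = refl
  signP≡signed (suc (suc k)) f = signP≡signed k f

  sumℤ≡sumℕ : ∀ {n} (f : Fin n → ℤ) (g : Fin n → ℕ) → (∀ j → f j ≡ + g j) → sumℤ f ≡ + sumℕ g
  sumℤ≡sumℕ {zero}  f g f≡g = refl
  sumℤ≡sumℕ {suc n} f g f≡g = cong₂ _+ℤ_ (f≡g zero) (sumℤ≡sumℕ (f ∘ suc) (g ∘ suc) (f≡g ∘ suc))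

  det≡det : ∀ {n} (M : Fin n → Fin n → Poly) → Defs.det M ≡ Determinant.det ℤ[X] M
  det≡det {zero}  M = refl
  det≡det {suc n} M = trans (sumFin≡sum (λ j → signP (toℕ j) (M zero j *P Defs.det (minor j)))) (sum-cong-≗ λ j →
    trans (signP≡signed (toℕ j) _) (cong (λ d → signed (toℕ j) (M zero j *P d)) (det≡det (minor j))))
    where
    minor : Fin (suc n) → Fin n → Fin n → Poly
    minor j r c = M (suc r) (punchIn j c)

module PowerGraphLaplacian (p : ℕ) (pr : Prime p) (enum : Fin (p ℕ.^ 3) ↔ Zp3.G p {{prime⇒nonZero pr}})
  (A : Fin (p ℕ.^ 3) → Fin (p ℕ.^ 3) → ℤ)
  (isAdjacency : ∀ i j → (Zp3.PowAdj p {{prime⇒nonZero pr}} (Inverse.to enum i) (Inverse.to enum j) → A i j ≡ + 1)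
                       × (¬ Zp3.PowAdj p {{prime⇒nonZero pr}} (Inverse.to enum i) (Inverse.to enum j) → A i j ≡ + 0)) where

  open import Data.Bool using (Bool; true; false; if_then_else_; _∨_; _∧_; not)
  open import Data.Integer using (-_) renaming (_+_ to _+ℤ_)
  open import Data.Nat using (zero; suc) renaming (_+_ to _+ℕ_; _*_ to _*ℕ_)
  import Data.Nat.Properties as ℕ
  open import Data.Fin using (zero; suc; toℕ)
  open import Data.Nat.DivMod using (_mod_)
  open import Data.Vec using (_∷_; [])
  import Data.Vec.Properties as Vec
  import Data.Fin.Properties as Fin
  open import Data.Product using (_,_; proj₁; proj₂)
  open import Data.Empty using (⊥-elim)
  open import Function using (_∘_)
  open import Data.Integer.Tactic.RingSolver using (solve-∀)
  open import Function.Bundles using (mk⇔; Injection)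
  open import Function.Properties.Inverse using (↔⇒↣; ↔-sym)
  import Data.Bool.Properties as Bool
  open import Relation.Nullary using (yes; no)
  open import Relation.Nullary.Decidable using (toSum)
  open import Data.Sum using ([_,_]′)
  open import Relation.Binary.PropositionalEquality as ≡ using (_≢_)

  open ElementaryAbelian p pr
  open Zp3 p hiding (_^_)
  open ClassMatrix ℤ[X] using (Shape; shape; IsClassStructure; classMatrix; weightSum; totalWeight; Factorisation; factorise)
  module D = Determinant ℤ[X]
  open DefsAgreement using (det≡det; sumℤ≡sumℕ)
  open RingIdentities ℤ[X] using (x-[1+c]+c≈x-1; [x-c][x-1]-c≈x[x-[1+c]]; x[yz]≈zy[x])
  open import Algebra.Bundles using (CommutativeRing; Semiring)
  open import Algebra.Definitions.RawSemiring (Semiring.rawSemiring (CommutativeRing.semiring ℤ[X])) using (_^_)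
    renaming (_×_ to _×ᴾ_)
  open import Data.Nat.Tactic.RingSolver using () renaming (solve-∀ to solveℕ-∀)
  module ℤX = CommutativeRing ℤ[X]
  open import Algebra.Properties.Semiring.Exp (CommutativeRing.semiring ℤ[X]) using (^-cong)

  n : ℕ
  n = p ℕ.^ 3

  to : Fin n → G
  to = Inverse.to enum

  from : G → Fin n
  from = Inverse.from enum

  to-injective : ∀ {u w} → to u ≡ to w → u ≡ w
  to-injective = Injection.injective (↔⇒↣ enum)

  from-injective : ∀ {x y} → from x ≡ from y → x ≡ y
  from-injective = Injection.injective (↔⇒↣ (↔-sym enum))

  apex : Fin n
  apex = from e

  isApex : Fin n → Bool
  isApex u = u == apex

  related : Fin n → Fin n → Bool
  related u w = to w ∈⟨ to u ⟩ᵇ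

  σ : Shape n
  σ = shape isApex related λ _ → 1

  to≢e : ∀ {u} → isApex u ≡ false → to u ≢ e
  to≢e {u} u∉A to≡e with ≡.trans (≡.sym u∉A) (≡⇒== (to-injective (≡.trans to≡e (≡.sym (Inverse.strictlyInverseˡ enum e)))))
  ... | ()

  to≡e : ∀ {u} → isApex u ≡ true → to u ≡ e
  to≡e u∈A = ≡.trans (≡.cong to (==⇒≡ u∈A)) (Inverse.strictlyInverseˡ enum e)

  adjacency : Fin n → Fin n → ℤ
  adjacency u w = if u == w then + 0 else if isApex u ∨ isApex w ∨ related u w then + 1 else + 0

  A≡adjacency : ∀ u w → A u w ≡ adjacency u w
  A≡adjacency u w with u == w in u≡w
  ... | true = proj₂ (isAdjacency u w) λ adj → PowAdj-irrefl (to w) (≡.subst (λ x → PowAdj (to x) (to w)) (==⇒≡ u≡w) adj)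
  ... | false with isApex u in u∈A | isApex w in w∈A
  ...   | true  | true  = ⊥-elim (==false⇒≢ u≡w (≡.trans (==⇒≡ u∈A) (≡.sym (==⇒≡ w∈A))))
  ...   | true  | false = proj₁ (isAdjacency u w) (≡.subst (λ x → PowAdj x (to w)) (≡.sym (to≡e u∈A)) (PowAdj-e (to w) (to≢e w∈A)))
  ...   | false | true  = proj₁ (isAdjacency u w) (≡.subst (PowAdj (to u)) (≡.sym (to≡e w∈A)) (PowAdj-to-e (to u) (to≢e u∈A)))
  ...   | false | false with to w ∈⟨ to u ⟩?
  ...     | yes w∈⟨u⟩ = proj₁ (isAdjacency u w) (∈⟨⟩⇒PowAdj (==false⇒≢ u≡w ∘ to-injective) (to≢e w∈A) w∈⟨u⟩)
  ...     | no w∉⟨u⟩  = proj₂ (isAdjacency u w) λ adj → w∉⟨u⟩ (PowAdj⇒∈⟨⟩ (to≢e u∈A) adj)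

  isApex-from : ∀ {y} → y ≢ e → isApex (from y) ≡ false
  isApex-from y≢e = ≢⇒==false (y≢e ∘ from-injective)

  classSize : ∀ w → isApex w ≡ false → weightSum σ (λ u → not (isApex u) ∧ related u w) ≡ p ∸ 1
  classSize w w∉A = begin
    sumℕ f             ≡⟨ sumℕ-image f φ φ-injective outside≡0 ⟩
    sumℕ (f ∘ φ)       ≡⟨ sumℕ-cong image≡1 ⟩
    sumℕ {p ∸ 1} (λ _ → 1) ≡⟨ sumℕ-const (p ∸ 1) 1 ⟩
    (p ∸ 1) *ℕ 1       ≡⟨ ℕ.*-identityʳ (p ∸ 1) ⟩
    p ∸ 1              ∎
    where
    open ≡.≡-Reasoning
    x = to w
    x≢e = to≢e w∉A
    f : Fin n → ℕ
    f u = indicator (not (isApex u) ∧ related u w)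
    φ : Fin (p ∸ 1) → Fin n
    φ s = from (generator x s)
    φ-injective : ∀ s t → φ s ≡ φ t → s ≡ t
    φ-injective s t eq = generator-injective x≢e s t (from-injective eq)
    image≡1 : ∀ s → f (φ s) ≡ 1
    image≡1 s = ≡.cong₂ (λ b c → indicator (not b ∧ c)) (isApex-from (generator≢e x≢e s))
      (≡.trans (≡.cong (x ∈⟨_⟩ᵇ) (Inverse.strictlyInverseˡ enum (generator x s))) (∈⟨⟩ᵇ-complete (generator-generates x≢e s)))
    outside≡0 : ∀ u → (∀ s → φ s ≢ u) → f u ≡ 0
    outside≡0 u u∉φ with isApex u in u∈A
    ... | true = ≡.refl
    ... | false with x ∈⟨ to u ⟩?
    ...   | no _ = ≡.refl
    ...   | yes x∈⟨u⟩ with generator-complete x≢e (to≢e u∈A) x∈⟨u⟩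
    ...     | s , u≡ = ⊥-elim (u∉φ s (to-injective (≡.trans (Inverse.strictlyInverseˡ enum _) (≡.sym u≡))))

  g₁ : G
  g₁ = (1 mod p) ∷ (0 mod p) ∷ (0 mod p) ∷ []

  g₁≢e : g₁ ≢ e
  g₁≢e eq with ≡.trans (≡.sym 1%p≡1) (≡.trans (≡.sym (toℕ-mod 1))
                (≡.trans (≡.cong toℕ (Vec.∷-injectiveˡ eq)) (≡.trans (toℕ-mod 0) 0%p≡0)))
  ... | ()

  isClassStructure : IsClassStructure σ (p ∸ 1)
  isClassStructure = record
    { apex          = apex
    ; isApex≡       = λ _ → ≡.refl
    ; nonApex       = from g₁ , isApex-from g₁≢e
    ; related-refl  = λ u _ → ∈⟨⟩ᵇ-complete (∈⟨⟩-refl (to u))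
    ; related-sym   = λ u w _ w∉A u∼w → ∈⟨⟩ᵇ-complete (∈⟨⟩-sym (to≢e w∉A) (∈⟨⟩ᵇ-sound u∼w))
    ; related-trans = λ u w x _ _ _ u∼w w∼x → ∈⟨⟩ᵇ-complete (∈⟨⟩-trans (∈⟨⟩ᵇ-sound u∼w) (∈⟨⟩ᵇ-sound w∼x))
    ; classWeight   = classSize
    }

  totalWeight≡ : totalWeight σ ≡ n ∸ 1
  totalWeight≡ = sumℕ-allBut apex

  degree-apex : degree A apex ≡ + (n ∸ 1)
  degree-apex = ≡.trans (sumℤ≡sumℕ (A apex) _ entry) (≡.cong +_ (sumℕ-allBut apex))
    where
    entry : ∀ w → A apex w ≡ + indicator (not (w == apex))
    entry w rewrite A≡adjacency apex w | ==-refl apex with w == apex in w≡apex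
    ... | true  rewrite ≡⇒== (≡.sym (==⇒≡ w≡apex)) = ≡.refl
    ... | false rewrite ≢⇒==false (==false⇒≢ w≡apex ∘ ≡.sym) = ≡.refl

  related-symmetric : ∀ u w → isApex u ≡ false → isApex w ≡ false → related u w ≡ related w u
  related-symmetric u w u∉A w∉A = Bool.⇔→≡ {z = true} (mk⇔ (sym u w u∉A w∉A) (sym w u w∉A u∉A))
    where open IsClassStructure isClassStructure renaming (related-sym to sym)

  -- The neighbours of w other than the identity are the classmates of w other than w itself.
  degree-nonApex : ∀ w → isApex w ≡ false → degree A w ≡ + (p ∸ 1)
  degree-nonApex w w∉A = ≡.trans (sumℤ≡sumℕ (A w) g entry) (≡.cong +_ (ℕ.+-cancelʳ-≡ _ _ _ (begin
    sumℕ g +ℕ 1                                  ≡⟨ ≡.cong (sumℕ g +ℕ_) (sumℕ-indicator w) ⟨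
    sumℕ g +ℕ sumℕ (λ j → indicator (j == w))    ≡⟨ sumℕ-distrib-+ g _ ⟨
    sumℕ (λ j → g j +ℕ indicator (j == w))       ≡⟨ sumℕ-cong swap ⟩
    sumℕ (λ j → h j +ℕ indicator (j == apex))    ≡⟨ sumℕ-distrib-+ h _ ⟩
    sumℕ h +ℕ sumℕ (λ j → indicator (j == apex)) ≡⟨ ≡.cong₂ _+ℕ_ (classSize w w∉A) (sumℕ-indicator apex) ⟩
    p ∸ 1 +ℕ 1                                   ∎)))
    where
    open ≡.≡-Reasoning
    g h : Fin n → ℕ
    g j = if w == j then 0 else indicator (isApex j ∨ related w j)
    h j = indicator (not (isApex j) ∧ related j w)
    entry : ∀ j → A w j ≡ + g j
    entry j rewrite A≡adjacency w j | w∉A with w == j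
    ... | true  = ≡.refl
    ... | false with isApex j ∨ related w j
    ...   | true  = ≡.refl
    ...   | false = ≡.refl
    at-w : ∀ {j} → j ≡ w → g j +ℕ indicator (j == w) ≡ h j +ℕ indicator (j == apex)
    at-w ≡.refl rewrite ==-refl w | w∉A | IsClassStructure.related-refl isClassStructure w w∉A = ≡.refl
    swap : ∀ j → g j +ℕ indicator (j == w) ≡ h j +ℕ indicator (j == apex)
    swap j with j == w in j≡w
    ... | true = ≡.subst (λ b → g j +ℕ indicator b ≡ h j +ℕ indicator (j == apex)) j≡w (at-w (==⇒≡ j≡w))
    ... | false rewrite ≢⇒==false (==false⇒≢ j≡w ∘ ≡.sym) with isApex j in j∈A
    ...   | true  = ≡.refl
    ...   | false rewrite related-symmetric w j w∉A j∈A = ≡.refl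

  a β : Poly
  a = X -P constP (+ (n ∸ 1))
  β = X -P constP (+ p)

  diagonal-nonApex : (X -P constP (+ (p ∸ 1) +ℤ - + 0)) ≈P (β +P oneP)
  diagonal-nonApex zero = ≡.trans (rearrange (+ (p ∸ 1))) (≡.cong (λ q → + 0 +ℤ - + q +ℤ + 1) (ℕ.suc-pred p))
    where
    rearrange : ∀ z → + 0 +ℤ - (z +ℤ - + 0) ≡ + 0 +ℤ - (+ 1 +ℤ z) +ℤ + 1
    rearrange = solve-∀
  diagonal-nonApex (suc k) = ≡.refl

  charMatrix-diagonal : ∀ u → charMatrix (laplacian A) u u ≡ X -P constP (degree A u +ℤ - + 0)
  charMatrix-diagonal u rewrite ==-refl u | A≡adjacency u u | ==-refl u = ≡.refl

  diagonal : ∀ u → charMatrix (laplacian A) u u ≈P classMatrix σ a β u u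
  diagonal u k with isApex u in u∈A
  ... | true = begin
    coeff (charMatrix (laplacian A) u u) k              ≡⟨ ≡.cong (λ f → coeff f k) (charMatrix-diagonal u) ⟩
    coeff (X -P constP (degree A u +ℤ - + 0)) k         ≡⟨ ≡.cong (λ v → coeff (X -P constP (degree A v +ℤ - + 0)) k) u≡apex ⟩
    coeff (X -P constP (degree A apex +ℤ - + 0)) k      ≡⟨ ≡.cong (λ d → coeff (X -P constP (d +ℤ - + 0)) k) degree-apex ⟩
    coeff (X -P constP (+ (n ∸ 1) +ℤ - + 0)) k          ≡⟨ ≡.cong (λ m → coeff (X -P constP (+ m)) k) (ℕ.+-identityʳ (n ∸ 1)) ⟩
    coeff a k                                           ≡⟨ ≡.cong (λ b → coeff (if b then a else oneP) k) (==-refl u) ⟨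
    coeff (if u == u then a else oneP) k                ∎
    where
    open ≡.≡-Reasoning
    u≡apex = ==⇒≡ u∈A
  ... | false = begin
    coeff (charMatrix (laplacian A) u u) k              ≡⟨ ≡.cong (λ f → coeff f k) (charMatrix-diagonal u) ⟩
    coeff (X -P constP (degree A u +ℤ - + 0)) k         ≡⟨ ≡.cong (λ d → coeff (X -P constP (d +ℤ - + 0)) k) (degree-nonApex u u∈A) ⟩
    coeff (X -P constP (+ (p ∸ 1) +ℤ - + 0)) k          ≡⟨ diagonal-nonApex k ⟩
    coeff (β +P oneP) k                                 ≡⟨ ≡.cong₂ (λ b c → coeff ((if b then β else zeroP) +P (if c then oneP else zeroP)) k)
                                                             (==-refl u) (IsClassStructure.related-refl isClassStructure u u∈A) ⟨
    coeff ((if u == u then β else zeroP) +P (if related u u then oneP else zeroP)) k ∎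
    where open ≡.≡-Reasoning

  offDiagonal : ∀ u w → u ≢ w → charMatrix (laplacian A) u w ≈P classMatrix σ a β u w
  offDiagonal u w u≢w rewrite A≡adjacency u w | ≢⇒==false u≢w with isApex u | isApex w
  ... | true  | true  = λ _ → ≡.refl
  ... | true  | false = λ _ → ≡.refl
  ... | false | true  = λ _ → ≡.refl
  ... | false | false with related u w
  ...   | true  = λ _ → ≡.refl
  ...   | false = constP0≈zeroP

  entry : ∀ u w → charMatrix (laplacian A) u w ≈P classMatrix σ a β u w
  entry u w = [ (λ { ≡.refl → diagonal u }) , offDiagonal u w ]′ (toSum (u Fin.≟ w))

  open Factorisation (factorise σ isClassStructure a β)

  n≡1+[p²+p+1][p-1] : n ≡ suc (suc (p ℕ.^ 2 +ℕ p) *ℕ (p ∸ 1))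
  n≡1+[p²+p+1][p-1] = ≡.trans (≡.cong (ℕ._^ 3) p≡)
    (≡.trans (identity (p ∸ 1)) (≡.cong (λ q → suc (suc (q ℕ.^ 2 +ℕ q) *ℕ (p ∸ 1))) (≡.sym p≡)))
    where
    p≡ : p ≡ suc (p ∸ 1)
    p≡ = ≡.sym (ℕ.suc-pred p)
    identity : ∀ q → (1 +ℕ q) *ℕ ((1 +ℕ q) *ℕ ((1 +ℕ q) *ℕ 1)) ≡
                     1 +ℕ (1 +ℕ ((1 +ℕ q) *ℕ ((1 +ℕ q) *ℕ 1) +ℕ (1 +ℕ q))) *ℕ q
    identity = solveℕ-∀

  k≡ : k ≡ p ℕ.^ 2 +ℕ p
  k≡ = ℕ.suc-injective (ℕ.*-cancelʳ-≡ (suc k) _ (p ∸ 1) {{ℕ.>-nonZero (ℕ.m<n⇒0<n∸m 1<p)}}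
         (≡.trans (≡.sym total) (≡.trans totalWeight≡ (≡.cong (_∸ 1) n≡1+[p²+p+1][p-1]))))

  r≡ : r ≡ n ∸ p ℕ.^ 2 ∸ p ∸ 2
  r≡ = ≡.sym (begin
    n ∸ p ℕ.^ 2 ∸ p ∸ 2                                 ≡⟨ ≡.cong (λ m → m ∸ p ℕ.^ 2 ∸ p ∸ 2) n≡ ⟩
    p ℕ.^ 2 +ℕ (p +ℕ (2 +ℕ r)) ∸ p ℕ.^ 2 ∸ p ∸ 2          ≡⟨ ≡.cong (λ m → m ∸ p ∸ 2) (ℕ.m+n∸m≡n (p ℕ.^ 2) _) ⟩
    p +ℕ (2 +ℕ r) ∸ p ∸ 2                               ≡⟨ ≡.cong (_∸ 2) (ℕ.m+n∸m≡n p _) ⟩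
    2 +ℕ r ∸ 2                                          ≡⟨ ℕ.m+n∸m≡n 2 r ⟩
    r                                                   ∎)
    where
    open ≡.≡-Reasoning
    n≡ : n ≡ p ℕ.^ 2 +ℕ (p +ℕ (2 +ℕ r))
    n≡ = ≡.trans size (≡.trans (≡.cong (λ m → 2 +ℕ m +ℕ r) k≡) (regroup (p ℕ.^ 2) p r))
      where
      regroup : ∀ x y z → 2 +ℕ (x +ℕ y) +ℕ z ≡ x +ℕ (y +ℕ (2 +ℕ z))
      regroup = solveℕ-∀

  d : Poly
  d = β +P (p ∸ 1) ×ᴾ oneP

  d≋X-1 : d ≋ (X -P oneP)
  d≋X-1 = begin
    β +P (p ∸ 1) ×ᴾ oneP                               ≡⟨ ≡.cong (λ m → X -P constP (+ m) +P (p ∸ 1) ×ᴾ oneP) (ℕ.suc-pred p) ⟨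
    X -P constP (+ suc (p ∸ 1)) +P (p ∸ 1) ×ᴾ oneP     ≈⟨ ℤX.+-congʳ (X-constP≋X-×oneP (suc (p ∸ 1))) ⟩
    X -P (oneP +P (p ∸ 1) ×ᴾ oneP) +P (p ∸ 1) ×ᴾ oneP  ≈⟨ x-[1+c]+c≈x-1 X ((p ∸ 1) ×ᴾ oneP) ⟩
    X -P oneP                                          ∎
    where open import Relation.Binary.Reasoning.Setoid ℤX.setoid

  quadratic : (a *P d -P totalWeight σ ×ᴾ oneP) ≋ (X *P (X -P constP (+ n)))
  quadratic = begin
    a *P d -P totalWeight σ ×ᴾ oneP
      ≈⟨ ℤX.+-cong (ℤX.*-cong (X-constP≋X-×oneP (n ∸ 1)) d≋X-1) (ℤX.-‿cong (ℤX.reflexive (≡.cong (_×ᴾ oneP) totalWeight≡))) ⟩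
    (X -P c) *P (X -P oneP) -P c                    ≈⟨ [x-c][x-1]-c≈x[x-[1+c]] X c ⟩
    X *P (X -P (oneP +P c))                         ≡⟨ ≡.cong (λ m → X *P (X -P m ×ᴾ oneP)) (ℕ.suc-pred n {{ℕ.m^n≢0 p 3}}) ⟩
    X *P (X -P n ×ᴾ oneP)                           ≈⟨ ℤX.*-congˡ {X} (X-constP≋X-×oneP n) ⟨
    X *P (X -P constP (+ n))                        ∎
    where
    open import Relation.Binary.Reasoning.Setoid ℤX.setoid
    c = (n ∸ 1) ×ᴾ oneP

  charPoly≋det-classMatrix : charPoly (laplacian A) ≋ D.det (classMatrix σ a β)
  charPoly≋det-classMatrix = ℤX.trans (ℤX.reflexive (det≡det (charMatrix (laplacian A)))) (D.det-cong λ u w → coeffwise (entry u w))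

  det-classMatrix≋factorised : D.det (classMatrix σ a β) ≋
    (X *P (X -P constP (+ n)) *P (X -P oneP) ^P (p ℕ.^ 2 ℕ.+ p) *P (X -P constP (+ p)) ^P (n ∸ p ℕ.^ 2 ∸ p ∸ 2))
  det-classMatrix≋factorised = begin
    D.det (classMatrix σ a β)
      ≈⟨ det≈ ⟩
    β ^ r *P (d ^ k *P (a *P d -P totalWeight σ ×ᴾ oneP))
      ≈⟨ ℤX.*-congˡ {β ^ r} (ℤX.*-cong (^-cong d≋X-1 (≡.refl {x = k})) quadratic) ⟩
    β ^ r *P ((X -P oneP) ^ k *P x[x-n])
      ≈⟨ x[yz]≈zy[x] (β ^ r) ((X -P oneP) ^ k) x[x-n] ⟩
    x[x-n] *P (X -P oneP) ^ k *P β ^ r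
      ≡⟨ ≡.cong₂ (λ f g → x[x-n] *P f *P g) (^≡^P (X -P oneP) k) (^≡^P β r) ⟩
    x[x-n] *P (X -P oneP) ^P k *P β ^P r
      ≡⟨ ≡.cong₂ (λ i j → x[x-n] *P (X -P oneP) ^P i *P β ^P j) k≡ r≡ ⟩
    x[x-n] *P (X -P oneP) ^P (p ℕ.^ 2 ℕ.+ p) *P β ^P (n ∸ p ℕ.^ 2 ∸ p ∸ 2) ∎
    where
    open import Relation.Binary.Reasoning.Setoid ℤX.setoid
    x[x-n] = X *P (X -P constP (+ n))

corollary2p9 : (p : ℕ) (pr : Prime p)
  → (enum : Fin (p ℕ.^ 3) ↔ Zp3.G p {{prime⇒nonZero pr}})
  → (A : Fin (p ℕ.^ 3) → Fin (p ℕ.^ 3) → ℤ)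
  → (∀ i j → (Zp3.PowAdj p {{prime⇒nonZero pr}} (Inverse.to enum i) (Inverse.to enum j) → A i j ≡ + 1)
           × (¬ Zp3.PowAdj p {{prime⇒nonZero pr}} (Inverse.to enum i) (Inverse.to enum j) → A i j ≡ + 0))
  → charPoly (laplacian A)
      ≈P (X *P (X -P constP (+ (p ℕ.^ 3))) *P (X -P oneP) ^P (p ℕ.^ 2 ℕ.+ p)
            *P (X -P constP (+ p)) ^P (p ℕ.^ 3 ∸ p ℕ.^ 2 ∸ p ∸ 2))
corollary2p9 p pr enum A isAdjacency = ≋⇒≈P (ℤX.trans charPoly≋det-classMatrix det-classMatrix≋factorised)
  where open PowerGraphLaplacian p pr enum A isAdjacency
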